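{- Let $k$ be an even natural number and $G$ a finite simple graph. Let $G(k)$ be the graph obtained from $G$ by subdividing every edge with $k$ new vertices (i.e. replacing each edge by a path with $k$ internal vertices). Then $G(k)$ is geodetic if and only if $G$ is geodetic.
   Context: A geodesic is a shortest path between two vertices; a graph is geodetic if between any two of its vertices there is exactly one geodesic. -}

module Defs where

open import Data.Nat using (ℕ; zero; suc; _≤_; _<ᵇ_)
open import Data.Fin using (Fin; zero; suc; toℕ)
open import Data.Bool using (Bool; T; _∧_)
open import Data.List using (List; []; _∷_; length)
open import Data.Maybe using (Maybe; just; nothing; maybe)
import Data.Maybe as Maybe
open import Data.Product using (Σ; Σ-syntax; ∃-syntax; _×_; _,_)
open import Data.Sum using (_⊎_; inj₁; inj₂)
open import Relation.Binary.PropositionalEquality using (_≡_)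

data IsWalk {V : Set} (A : V → V → Set) : V → V → List V → Set where
  here : ∀ {u} → IsWalk A u u (u ∷ [])
  step : ∀ {u w v ws} → A u w → IsWalk A w v ws → IsWalk A u v (u ∷ ws)

-- A geodesic: a walk from u to v of minimum length among all u–v walks
-- (the length of a walk is its number of vertices minus one; comparing
-- numbers of vertices is equivalent). Shortest walks are paths.
IsGeodesic : {V : Set} (A : V → V → Set) → V → V → List V → Set
IsGeodesic A u v ws =
  IsWalk A u v ws × (∀ ws′ → IsWalk A u v ws′ → length ws ≤ length ws′)

Geodetic : {V : Set} (A : V → V → Set) → Set
Geodetic {V} A = ∀ (u v : V) →
  Σ[ ws ∈ List V ] (IsGeodesic A u v ws ×
                    (∀ ws′ → IsGeodesic A u v ws′ → ws′ ≡ ws))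

record SimpleGraph : Set where
  field
    n     : ℕ
    adj   : Fin n → Fin n → Bool
    sym   : ∀ i j → adj i j ≡ adj j i
    irrefl : ∀ i → adj i i ≡ Data.Bool.false

open SimpleGraph public

Adj : (G : SimpleGraph) → Fin (n G) → Fin (n G) → Set
Adj G i j = T (adj G i j)

-- An edge {i , j} of G, listed once via its orientation i < j.
Edge : SimpleGraph → Set
Edge G = Σ[ i ∈ Fin (n G) ] Σ[ j ∈ Fin (n G) ]
           T (adj G i j ∧ (toℕ i <ᵇ toℕ j))

-- The subdivision G(k): every edge {i , j} (i < j) is replaced by a path
-- i = p₀ , p₁ , … , p_k , p_{k+1} = j whose k internal vertices are new.

SubV : SimpleGraph → ℕ → Set
SubV G k = Fin (n G) ⊎ (Edge G × Fin k)

-- inner k m : for the position m+1 (m ∈ {0..k}) on a subdivided edge,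
-- the index of the internal vertex, or nothing if m+1 = k+1 (endpoint j).
inner : ∀ k → Fin (suc k) → Maybe (Fin k)
inner zero    zero    = nothing
inner (suc k) zero    = just zero
inner (suc k) (suc m) = Maybe.map suc (inner k m)

-- pos e m : the vertex at position m ∈ {0 , … , k+1} on the path replacing e.
pos : (G : SimpleGraph) (k : ℕ) → Edge G → Fin (suc (suc k)) → SubV G k
pos G k (i , j , p) zero    = inj₁ i
pos G k (i , j , p) (suc m) =
  maybe (λ t → inj₂ ((i , j , p) , t)) (inj₁ j) (inner k m)

Step : (G : SimpleGraph) (k : ℕ) → SubV G k → SubV G k → Set
Step G k x y = Σ[ e ∈ Edge G ] Σ[ m ∈ Fin (suc k) ]
  (x ≡ pos G k e (Data.Fin.inject₁ m) × y ≡ pos G k e (suc m))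

SubAdj : (G : SimpleGraph) (k : ℕ) → SubV G k → SubV G k → Set
SubAdj G k x y = Step G k x y ⊎ Step G k y x

-- A graph is geodetic exactly when, for every target v, the distance F to v has the property that
-- every vertex x ≠ v has exactly one neighbour y with F y + 1 = F x; conversely any function with
-- F v = 0, steps of at most one, and exactly one such neighbour everywhere is the distance to v.
-- If G(k) is geodetic, the distance in G(k) to an original vertex is N = k + 1 times such a function
-- on G, since a shortest walk that enters a subdivided edge must run through it.  If G is geodetic,
-- the distance in G(k) to any target is given explicitly by the distances in G (for a target inside
-- the edge i j: the shorter of the routes through i and through j), and its unique-descent property
-- can only fail at a tie inside an edge, which is excluded by parity because N is odd.

module Submission where

open import Data.Bool using (Bool; true; false; T)
open import Data.Bool.Properties using (T-∧; T-irrelevant)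
open import Data.Empty using (⊥; ⊥-elim)
open import Data.Fin using (Fin; zero; suc; toℕ; fromℕ<; inject₁)
import Data.Fin.Properties as Fin
open import Data.List using (List; []; _∷_; length)
open import Data.Maybe using (Maybe; just; nothing; maybe)
import Data.Maybe as Maybe
open import Data.Nat
open import Data.Nat.Divisibility using (_∣_; divides)
open import Data.Nat.Properties
open import Algebra.Properties.CommutativeSemigroup +-commutativeSemigroup using (x∙yz≈y∙xz)
open import Data.Nat.Tactic.RingSolver using (solve-∀)
open import Data.Product using (Σ-syntax; ∃-syntax; _×_; _,_; proj₁; proj₂)
open import Data.Sum using (_⊎_; inj₁; inj₂; swap)
open import Data.Sum.Properties using (inj₁-injective; inj₂-injective)
open import Function.Bundles using (_⇔_; mk⇔; Equivalence)
open import Relation.Binary.Definitions using (tri<; tri≈; tri>)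
open import Relation.Binary.PropositionalEquality
open import Relation.Nullary using (Dec; yes; no; does; ¬_)
open import Relation.Nullary.Decidable using (_×-dec_; _⊎-dec_; dec-true; dec-false; does-⇔)

open import Defs renaming (sym to adj-sym; n to order)

record IsGeodeticDistance {V : Set} (A : V → V → Set) (v : V) (F : V → ℕ) : Set where
  field
    target-zero    : F v ≡ 0
    zero⇒target    : ∀ x → F x ≡ 0 → x ≡ v
    adjacent-≤     : ∀ x y → A x y → F x ≤ suc (F y)
    descent        : ∀ x d → F x ≡ suc d → ∃[ y ] A x y × F y ≡ d
    descent-unique : ∀ x d y y′ → F x ≡ suc d → A x y → F y ≡ d → A x y′ → F y′ ≡ d → y ≡ y′

walk-length-pos : ∀ {V} {A : V → V → Set} {x y ws} → IsWalk A x y ws → 1 ≤ length ws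
walk-length-pos here       = s≤s z≤n
walk-length-pos (step _ _) = s≤s z≤n

module _ {V : Set} {A : V → V → Set} {v : V} {F : V → ℕ} (D : IsGeodeticDistance A v F) where
  open IsGeodeticDistance D

  descending-walk : ∀ x → ∃[ ws ] IsWalk A x v ws × length ws ≡ suc (F x)
  descending-walk x = go (F x) x refl
    where
    go : ∀ n x → F x ≡ n → ∃[ ws ] IsWalk A x v ws × length ws ≡ suc n
    go zero    x eq rewrite zero⇒target x eq = _ , here , refl
    go (suc n) x eq with descent x n eq
    ... | y , x~y , Fy with go n y Fy
    ... | ws , w , len = x ∷ ws , step x~y w , cong suc len

  distance-≤-walk : ∀ x ws → IsWalk A x v ws → suc (F x) ≤ length ws
  distance-≤-walk x _ here rewrite target-zero = s≤s z≤n
  distance-≤-walk x _ (step {w = w} {ws = ws} x~w walk) =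
    s≤s (≤-trans (adjacent-≤ x w x~w) (distance-≤-walk w ws walk))

  first-step-distance : ∀ {x w ws} → A x w → IsWalk A w v ws → length ws ≡ F x → F x ≡ suc (F w)
  first-step-distance {x} {w} {ws} x~w walk len =
    ≤-antisym (adjacent-≤ x w x~w) (subst (suc (F w) ≤_) len (distance-≤-walk w ws walk))

  shortest-walk-unique : ∀ x ws₁ ws₂ → IsWalk A x v ws₁ → IsWalk A x v ws₂ →
    length ws₁ ≡ suc (F x) → length ws₂ ≡ suc (F x) → ws₁ ≡ ws₂
  shortest-walk-unique x _ _ here here _ _ = refl
  shortest-walk-unique x _ _ here (step _ walk) l₁ l₂ =
    ⊥-elim (1+n≰n (subst (1 ≤_) (trans (suc-injective l₂) (sym (suc-injective l₁))) (walk-length-pos walk)))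
  shortest-walk-unique x _ _ (step _ walk) here l₁ l₂ =
    ⊥-elim (1+n≰n (subst (1 ≤_) (trans (suc-injective l₁) (sym (suc-injective l₂))) (walk-length-pos walk)))
  shortest-walk-unique x _ _ (step {w = w₁} {ws = ws₁} x~w₁ walk₁) (step {w = w₂} {ws = ws₂} x~w₂ walk₂) l₁ l₂
    with first-step-distance x~w₁ walk₁ (suc-injective l₁) | first-step-distance x~w₂ walk₂ (suc-injective l₂)
  ... | Fx₁ | Fx₂ with descent-unique x (F w₁) w₁ w₂ Fx₁ x~w₁ refl x~w₂ (suc-injective (trans (sym Fx₂) Fx₁))
  ... | refl = cong (x ∷_) (shortest-walk-unique w₁ ws₁ ws₂ walk₁ walk₂
                 (trans (suc-injective l₁) Fx₁) (trans (suc-injective l₂) Fx₂))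

  unique-geodesic-to-target : ∀ x → ∃[ ws ] IsGeodesic A x v ws × (∀ ws′ → IsGeodesic A x v ws′ → ws′ ≡ ws)
  unique-geodesic-to-target x with descending-walk x
  ... | ws , walk , len =
    ws , (walk , λ ws′ walk′ → subst (_≤ length ws′) (sym len) (distance-≤-walk x ws′ walk′)) ,
    λ ws′ (walk′ , minimal′) → shortest-walk-unique x ws′ ws walk′ walk
      (≤-antisym (subst (length ws′ ≤_) len (minimal′ ws walk)) (distance-≤-walk x ws′ walk′)) len

geodetic-from-distances : ∀ {V} (A : V → V → Set) →
  (∀ v → ∃[ F ] IsGeodeticDistance A v F) → Geodetic A
geodetic-from-distances A distances u v = unique-geodesic-to-target (proj₂ (distances v)) u

module GeodeticDistance {V : Set} (A : V → V → Set) (geodetic : Geodetic A) (v : V) where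

  geodesic : V → List V
  geodesic x = proj₁ (geodetic x v)

  geodesic-walk : ∀ x → IsWalk A x v (geodesic x)
  geodesic-walk x = proj₁ (proj₁ (proj₂ (geodetic x v)))

  geodesic-minimal : ∀ x ws → IsWalk A x v ws → length (geodesic x) ≤ length ws
  geodesic-minimal x = proj₂ (proj₁ (proj₂ (geodetic x v)))

  geodesic-unique : ∀ x ws → IsGeodesic A x v ws → ws ≡ geodesic x
  geodesic-unique x = proj₂ (proj₂ (geodetic x v))

  dist : V → ℕ
  dist x = pred (length (geodesic x))

  length-geodesic : ∀ x → length (geodesic x) ≡ suc (dist x)
  length-geodesic x = go (geodesic-walk x)
    where
    go : ∀ {x y ws} → IsWalk A x y ws → length ws ≡ suc (pred (length ws))
    go here       = refl
    go (step _ _) = refl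

  dist≡0⇒target : ∀ x → dist x ≡ 0 → x ≡ v
  dist≡0⇒target x eq = go (geodesic-walk x) (trans (length-geodesic x) (cong suc eq))
    where
    go : ∀ {ws} → IsWalk A x v ws → length ws ≡ 1 → x ≡ v
    go here              _  = refl
    go (step _ here)     ()
    go (step _ (step _ _)) ()

  dist-adjacent-≤ : ∀ x y → A x y → dist x ≤ suc (dist y)
  dist-adjacent-≤ x y x~y = ≤-pred (subst₂ _≤_ (length-geodesic x) (cong suc (length-geodesic y))
    (geodesic-minimal x _ (step x~y (geodesic-walk y))))

  dist-descent : ∀ x d → dist x ≡ suc d → ∃[ y ] A x y × dist y ≡ d
  dist-descent x d eq = go (geodesic-walk x) (trans (length-geodesic x) (cong suc eq))
    where
    go : ∀ {ws} → IsWalk A x v ws → length ws ≡ suc (suc d) → ∃[ y ] A x y × dist y ≡ d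
    go (step {w = w} {ws = ws} x~w walk) len = w , x~w , ≤-antisym
      (≤-pred (subst₂ _≤_ (length-geodesic w) (suc-injective len) (geodesic-minimal w ws walk)))
      (≤-pred (subst (_≤ suc (dist w)) eq (dist-adjacent-≤ x w x~w)))

  geodesic-via : ∀ x d z → dist x ≡ suc d → A x z → dist z ≡ d → IsGeodesic A x v (x ∷ geodesic z)
  geodesic-via x d z eq x~z dz = step x~z (geodesic-walk z) , λ ws walk → subst (_≤ length ws)
    (trans (length-geodesic x) (cong suc (trans eq (trans (cong suc (sym dz)) (sym (length-geodesic z))))))
    (geodesic-minimal x ws walk)

  dist-descent-unique : ∀ x d y y′ → dist x ≡ suc d → A x y → dist y ≡ d → A x y′ → dist y′ ≡ d → y ≡ y′
  dist-descent-unique x d y y′ eq x~y dy x~y′ dy′ =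
    walk-start (geodesic-walk y) (geodesic-walk y′) (cong tail (trans
      (geodesic-unique x _ (geodesic-via x d y eq x~y dy))
      (sym (geodesic-unique x _ (geodesic-via x d y′ eq x~y′ dy′)))))
    where
    tail : List V → List V
    tail []       = []
    tail (_ ∷ ws) = ws
    walk-start : ∀ {a b ws ws′} → IsWalk A a v ws → IsWalk A b v ws′ → ws ≡ ws′ → a ≡ b
    walk-start here       here       refl = refl
    walk-start here       (step _ _) refl = refl
    walk-start (step _ _) here       refl = refl
    walk-start (step _ _) (step _ _) refl = refl

  isGeodeticDistance : IsGeodeticDistance A v dist
  isGeodeticDistance = record
    { target-zero    = suc-injective (≤-antisym (subst (_≤ 1) (length-geodesic v) (geodesic-minimal v _ here)) (s≤s z≤n))
    ; zero⇒target    = dist≡0⇒target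
    ; adjacent-≤     = dist-adjacent-≤
    ; descent        = dist-descent
    ; descent-unique = dist-descent-unique
    }

module _ {V : Set} {A : V → V → Set} where
  open IsGeodeticDistance

  distance-triangle : ∀ {x₁ x₂ g₁ g₂} → IsGeodeticDistance A x₁ g₁ → IsGeodeticDistance A x₂ g₂ →
    ∀ z → g₂ z ≤ g₁ z + g₂ x₁
  distance-triangle {x₁} {x₂} {g₁} {g₂} D₁ D₂ z = go (g₁ z) z refl
    where
    go : ∀ n z → g₁ z ≡ n → g₂ z ≤ g₁ z + g₂ x₁
    go zero z e with zero⇒target D₁ z e
    ... | refl = subst (λ q → g₂ x₁ ≤ q + g₂ x₁) (sym e) ≤-refl
    go (suc n) z e with descent D₁ z n e
    ... | y , z~y , g₁y = subst (λ q → g₂ z ≤ q + g₂ x₁) (sym e)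
      (≤-trans (adjacent-≤ D₂ z y z~y) (s≤s (subst (λ q → g₂ y ≤ q + g₂ x₁) g₁y (go n y g₁y))))

  adjacent-distance-one : ∀ {x g} → IsGeodeticDistance A x g → ∀ y → A y x → y ≢ x → g y ≡ 1
  adjacent-distance-one {x} {g} D y y~x y≢x with g y in gy | adjacent-≤ D y x y~x
  ... | zero  | _ = ⊥-elim (y≢x (zero⇒target D y gy))
  ... | suc _ | le rewrite target-zero D with le
  ... | s≤s z≤n = refl

  -- The first step from u towards x₁ is, by the triangle inequality, also a shortest step towards x₂,
  -- hence it is w; but w is not closer to x₁, so only α = 0 remains.
  crossing-edge : ∀ {x₁ x₂ g₁ g₂} → IsGeodeticDistance A x₁ g₁ → IsGeodeticDistance A x₂ g₂ → g₂ x₁ ≤ 1 →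
    ∀ α u w → A u w → g₁ u ≡ α → g₂ w ≡ α → g₂ u ≡ suc α → α ≤ g₁ w → u ≡ x₁ × w ≡ x₂
  crossing-edge D₁ D₂ x₁x₂≤1 zero u w _ g₁u g₂w _ _ = zero⇒target D₁ u g₁u , zero⇒target D₂ w g₂w
  crossing-edge {g₁ = g₁} {g₂} D₁ D₂ x₁x₂≤1 (suc α) u w u~w g₁u g₂w g₂u α<g₁w
    with descent D₁ u α g₁u
  ... | y , u~y , g₁y
    with descent-unique D₂ u (suc α) y w g₂u u~y (≤-antisym upper lower) u~w g₂w
    where
    upper : g₂ y ≤ suc α
    upper = ≤-trans (distance-triangle D₁ D₂ y)
      (subst (λ q → q + _ ≤ suc α) (sym g₁y) (≤-trans (+-monoʳ-≤ α x₁x₂≤1) (≤-reflexive (+-comm α 1))))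
    lower : suc α ≤ g₂ y
    lower = ≤-pred (subst (_≤ suc (g₂ y)) g₂u (adjacent-≤ D₂ u y u~y))
  ... | refl = ⊥-elim (1+n≰n (subst (suc α ≤_) g₁y α<g₁w))

m∸n≡1+[m∸1+n] : ∀ m n → n < m → m ∸ n ≡ suc (m ∸ suc n)
m∸n≡1+[m∸1+n] (suc m) n (s≤s n≤m) = +-∸-assoc 1 n≤m

innerℕ : (k : ℕ) → ℕ → Maybe (Fin k)
innerℕ zero    a       = nothing
innerℕ (suc k) zero    = just zero
innerℕ (suc k) (suc a) = Maybe.map suc (innerℕ k a)

inner≡innerℕ : ∀ k (m : Fin (suc k)) → inner k m ≡ innerℕ k (toℕ m)
inner≡innerℕ zero    zero    = refl
inner≡innerℕ (suc k) zero    = refl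
inner≡innerℕ (suc k) (suc m) = cong (Maybe.map suc) (inner≡innerℕ k m)

innerℕ-≥ : ∀ k a → k ≤ a → innerℕ k a ≡ nothing
innerℕ-≥ zero    a       _         = refl
innerℕ-≥ (suc k) (suc a) (s≤s k≤a) = cong (Maybe.map suc) (innerℕ-≥ k a k≤a)

innerℕ-toℕ : ∀ k (t : Fin k) → innerℕ k (toℕ t) ≡ just t
innerℕ-toℕ (suc k) zero    = refl
innerℕ-toℕ (suc k) (suc t) = cong (Maybe.map suc) (innerℕ-toℕ k t)

innerℕ≡just⇒ : ∀ k a (t : Fin k) → innerℕ k a ≡ just t → toℕ t ≡ a
innerℕ≡just⇒ (suc k) zero    .zero refl = refl
innerℕ≡just⇒ (suc k) (suc a) t     eq with innerℕ k a in e
innerℕ≡just⇒ (suc k) (suc a) .(suc t′) refl | just t′ = cong suc (innerℕ≡just⇒ k a t′ e)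

innerℕ≡nothing⇒ : ∀ k a → innerℕ k a ≡ nothing → k ≤ a
innerℕ≡nothing⇒ zero    a       _  = z≤n
innerℕ≡nothing⇒ (suc k) (suc a) eq with innerℕ k a in e
innerℕ≡nothing⇒ (suc k) (suc a) refl | nothing = s≤s (innerℕ≡nothing⇒ k a e)

Adj-sym : ∀ (G : SimpleGraph) {u w} → Adj G u w → Adj G w u
Adj-sym G {u} {w} = subst T (adj-sym G u w)

Adj-irrefl : ∀ (G : SimpleGraph) {u} → ¬ Adj G u u
Adj-irrefl G {u} = subst T (irrefl G u)

module Subdivision (G : SimpleGraph) (k : ℕ) where

  N : ℕ
  N = suc k

  Vertex : Set
  Vertex = Fin (order G)

  src tgt : Edge G → Vertex
  src e = proj₁ e
  tgt e = proj₁ (proj₂ e)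

  edge-adj : (e : Edge G) → Adj G (src e) (tgt e)
  edge-adj (i , j , p) = proj₁ (Equivalence.to T-∧ p)

  src<tgt : (e : Edge G) → toℕ (src e) < toℕ (tgt e)
  src<tgt (i , j , p) = <ᵇ⇒< (toℕ i) (toℕ j) (proj₂ (Equivalence.to T-∧ p))

  src≢tgt : ∀ e → src e ≢ tgt e
  src≢tgt e eq = <-irrefl (cong toℕ eq) (src<tgt e)

  edge-≡ : ∀ e e′ → src e ≡ src e′ → tgt e ≡ tgt e′ → e ≡ e′
  edge-≡ (i , j , p) (.i , .j , q) refl refl = cong (λ z → i , j , z) (T-irrelevant p q)

  ¬edge-reversed : ∀ e e′ → src e ≡ tgt e′ → tgt e ≡ src e′ → ⊥
  ¬edge-reversed e e′ s t =
    <-asym (src<tgt e) (subst₂ _<_ (cong toℕ (sym t)) (cong toℕ (sym s)) (src<tgt e′))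

  Joins : Edge G → Vertex → Vertex → Set
  Joins e u w = (src e ≡ u × tgt e ≡ w) ⊎ (src e ≡ w × tgt e ≡ u)

  Joins-functional : ∀ e {u w w′} → Joins e u w → Joins e u w′ → w ≡ w′
  Joins-functional e (inj₁ (_ , b)) (inj₁ (_ , d)) = trans (sym b) d
  Joins-functional e (inj₁ (a , _)) (inj₂ (_ , d)) = ⊥-elim (src≢tgt e (trans a (sym d)))
  Joins-functional e (inj₂ (_ , b)) (inj₁ (c , _)) = ⊥-elim (src≢tgt e (trans c (sym b)))
  Joins-functional e (inj₂ (a , _)) (inj₂ (c , _)) = trans (sym a) c

  Joins-sym : ∀ {e u w} → Joins e u w → Joins e w u
  Joins-sym (inj₁ (s , t)) = inj₂ (s , t)
  Joins-sym (inj₂ (s , t)) = inj₁ (s , t)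

  -- Positions are counted from src e; those beyond N stay at tgt e.
  onEdge : Edge G → ℕ → SubV G k
  onEdge e zero    = inj₁ (src e)
  onEdge e (suc a) = maybe (λ t → inj₂ (e , t)) (inj₁ (tgt e)) (innerℕ k a)

  pos≡onEdge : ∀ e (m : Fin (suc N)) → pos G k e m ≡ onEdge e (toℕ m)
  pos≡onEdge (i , j , p) zero    = refl
  pos≡onEdge (i , j , p) (suc m) =
    cong (maybe (λ t → inj₂ ((i , j , p) , t)) (inj₁ j)) (inner≡innerℕ k m)

  onEdge-N : ∀ e → onEdge e N ≡ inj₁ (tgt e)
  onEdge-N e rewrite innerℕ-≥ k k ≤-refl = refl

  onEdge-inner : ∀ e (t : Fin k) → onEdge e (suc (toℕ t)) ≡ inj₂ (e , t)
  onEdge-inner e t rewrite innerℕ-toℕ k t = refl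

  onEdge≡inj₂ : ∀ e a e′ t → onEdge e a ≡ inj₂ (e′ , t) → e ≡ e′ × a ≡ suc (toℕ t)
  onEdge≡inj₂ e zero    e′ t ()
  onEdge≡inj₂ e (suc a) e′ t eq with innerℕ k a in ie
  onEdge≡inj₂ e (suc a) .e .t′ refl | just t′ = refl , cong suc (sym (innerℕ≡just⇒ k a t′ ie))
  onEdge≡inj₂ e (suc a) e′ t () | nothing

  onEdge≡inj₁ : ∀ e a u → onEdge e a ≡ inj₁ u → (a ≡ 0 × u ≡ src e) ⊎ (N ≤ a × u ≡ tgt e)
  onEdge≡inj₁ e zero    u refl = inj₁ (refl , refl)
  onEdge≡inj₁ e (suc a) u eq with innerℕ k a in ie
  onEdge≡inj₁ e (suc a) u () | just t′
  onEdge≡inj₁ e (suc a) .(tgt e) refl | nothing = inj₂ (s≤s (innerℕ≡nothing⇒ k a ie) , refl)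

  onEdge-interior : ∀ e a → 1 ≤ a → a ≤ k → ∃[ t ] onEdge e a ≡ inj₂ (e , t) × a ≡ suc (toℕ t)
  onEdge-interior e (suc a) _ a<k =
    t , subst (λ z → onEdge e (suc z) ≡ inj₂ (e , t)) (Fin.toℕ-fromℕ< a<k) (onEdge-inner e t) ,
    cong suc (sym (Fin.toℕ-fromℕ< a<k))
    where t = fromℕ< a<k

  step-onEdge : ∀ {x y} → Step G k x y →
    Σ[ e ∈ Edge G ] Σ[ a ∈ ℕ ] a ≤ k × x ≡ onEdge e a × y ≡ onEdge e (suc a)
  step-onEdge (e , m , px , py) = e , toℕ m , ≤-pred (Fin.toℕ<n m) ,
    trans px (trans (pos≡onEdge e (inject₁ m)) (cong (onEdge e) (Fin.toℕ-inject₁ m))) ,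
    trans py (pos≡onEdge e (suc m))

  onEdge-step : ∀ e a → a ≤ k → Step G k (onEdge e a) (onEdge e (suc a))
  onEdge-step e a a≤k = e , m ,
    sym (trans (pos≡onEdge e (inject₁ m)) (cong (onEdge e) (trans (Fin.toℕ-inject₁ m) (Fin.toℕ-fromℕ< (s≤s a≤k))))) ,
    sym (trans (pos≡onEdge e (suc m)) (cong (λ z → onEdge e (suc z)) (Fin.toℕ-fromℕ< (s≤s a≤k))))
    where m = fromℕ< (s≤s a≤k)

  onEdge-neighbours : ∀ e a y → 1 ≤ a → a ≤ k → SubAdj G k (onEdge e a) y →
    y ≡ onEdge e (pred a) ⊎ y ≡ onEdge e (suc a)
  onEdge-neighbours e a y 1≤a a≤k adj with onEdge-interior e a 1≤a a≤k
  ... | t , at , a≡ = go adj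
    where
    go : SubAdj G k (onEdge e a) y → y ≡ onEdge e (pred a) ⊎ y ≡ onEdge e (suc a)
    go (inj₁ s) with step-onEdge s
    ... | e′ , a′ , _ , px , py with onEdge≡inj₂ e′ a′ e t (trans (sym px) at)
    ... | refl , a′≡ = inj₂ (trans py (cong (λ z → onEdge e (suc z)) (trans a′≡ (sym a≡))))
    go (inj₂ s) with step-onEdge s
    ... | e′ , a′ , _ , py , px with onEdge≡inj₂ e′ (suc a′) e t (trans (sym px) at)
    ... | refl , a′≡ = inj₁ (trans py (cong (onEdge e) (cong pred (trans a′≡ (sym a≡)))))

  orientedPath : ∀ u w → Adj G u w → Dec (toℕ u < toℕ w) → ℕ → SubV G k
  orientedPath u w p (yes u<w) a = onEdge (u , w , Equivalence.from T-∧ (p , <⇒<ᵇ u<w)) a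
  orientedPath u w p (no  u≮w) a = onEdge (w , u , Equivalence.from T-∧ (Adj-sym G p , <⇒<ᵇ w<u)) (N ∸ a)
    where
    w<u : toℕ w < toℕ u
    w<u = ≤∧≢⇒< (≮⇒≥ u≮w) (λ eq → Adj-irrefl G (subst (Adj G u) (Fin.toℕ-injective eq) p))

  path : ∀ u w → Adj G u w → ℕ → SubV G k
  path u w p = orientedPath u w p (toℕ u <? toℕ w)

  PathAlong : Vertex → Vertex → (ℕ → SubV G k) → Set
  PathAlong u w L = Σ[ e ∈ Edge G ]
    ((src e ≡ u × tgt e ≡ w × (∀ a → L a ≡ onEdge e a)) ⊎
     (src e ≡ w × tgt e ≡ u × (∀ a → L a ≡ onEdge e (N ∸ a))))

  path-along : ∀ u w p → PathAlong u w (path u w p)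
  path-along u w p = go (toℕ u <? toℕ w)
    where
    go : ∀ d → PathAlong u w (orientedPath u w p d)
    go (yes _) = _ , inj₁ (refl , refl , λ _ → refl)
    go (no _)  = _ , inj₂ (refl , refl , λ _ → refl)

  path-start : ∀ u w p → path u w p 0 ≡ inj₁ u
  path-start u w p with path-along u w p
  ... | e , inj₁ (s , _ , L) = trans (L 0) (cong inj₁ s)
  ... | e , inj₂ (_ , t , L) = trans (L 0) (trans (onEdge-N e) (cong inj₁ t))

  path-end : ∀ u w p → path u w p N ≡ inj₁ w
  path-end u w p with path-along u w p
  ... | e , inj₁ (_ , t , L) = trans (L N) (trans (onEdge-N e) (cong inj₁ t))
  ... | e , inj₂ (s , _ , L) = trans (L N) (trans (cong (onEdge e) (n∸n≡0 N)) (cong inj₁ s))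

  path-adjacent : ∀ u w p a → a ≤ k → SubAdj G k (path u w p a) (path u w p (suc a))
  path-adjacent u w p a a≤k with path-along u w p
  ... | e , inj₁ (_ , _ , L) = subst₂ (SubAdj G k) (sym (L a)) (sym (L (suc a))) (inj₁ (onEdge-step e a a≤k))
  ... | e , inj₂ (_ , _ , L) =
    subst₂ (SubAdj G k) (sym (trans (L a) (cong (onEdge e) (+-∸-assoc 1 a≤k)))) (sym (L (suc a)))
      (inj₂ (onEdge-step e (k ∸ a) (m∸n≤m k a)))

  path-first-step : ∀ u w p → SubAdj G k (inj₁ u) (path u w p 1)
  path-first-step u w p = subst (λ z → SubAdj G k z (path u w p 1)) (path-start u w p) (path-adjacent u w p 0 z≤n)

  path-interior : ∀ u w p a → 1 ≤ a → a ≤ k → ∃[ z ] path u w p a ≡ inj₂ z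
  path-interior u w p a 1≤a a≤k with path-along u w p
  ... | e , inj₁ (_ , _ , L) with onEdge-interior e a 1≤a a≤k
  ... | _ , eq , _ = _ , trans (L a) eq
  path-interior u w p (suc a) _ a<k | e , inj₂ (_ , _ , L)
    with onEdge-interior e (suc (k ∸ suc a)) (s≤s z≤n) (∸-monoʳ-< (s≤s z≤n) a<k)
  ... | _ , eq , _ = _ , trans (L (suc a)) (trans (cong (onEdge e) (+-∸-assoc 1 a<k)) eq)

  path-neighbours : ∀ u w p a y → 1 ≤ a → a ≤ k → SubAdj G k (path u w p a) y →
    y ≡ path u w p (pred a) ⊎ y ≡ path u w p (suc a)
  path-neighbours u w p a y 1≤a a≤k adj with path-along u w p
  ... | e , inj₁ (_ , _ , L) with onEdge-neighbours e a y 1≤a a≤k (subst (λ z → SubAdj G k z y) (L a) adj)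
  ... | inj₁ q = inj₁ (trans q (sym (L (pred a))))
  ... | inj₂ q = inj₂ (trans q (sym (L (suc a))))
  path-neighbours u w p (suc a) y _ a<k adj | e , inj₂ (_ , _ , L)
    with onEdge-neighbours e (suc (k ∸ suc a)) y (s≤s z≤n) (∸-monoʳ-< (s≤s z≤n) a<k)
           (subst (λ z → SubAdj G k z y) (trans (L (suc a)) (cong (onEdge e) (+-∸-assoc 1 a<k))) adj)
  ... | inj₁ q = inj₂ (trans q (sym (L (suc (suc a)))))
  ... | inj₂ q = inj₁ (trans q (sym (trans (L a) (cong (onEdge e)
                   (trans (+-∸-assoc 1 (≤-trans (n≤1+n a) a<k)) (cong suc (m∸n≡1+[m∸1+n] k a a<k)))))))

  path-second-vertex : ∀ u w p → 1 ≤ k → Σ[ e ∈ Edge G ] Σ[ t ∈ Fin k ] path u w p 1 ≡ inj₂ (e , t) × Joins e u w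
  path-second-vertex u w p 1≤k with path-along u w p
  ... | e , inj₁ (s , t , L) with onEdge-interior e 1 (s≤s z≤n) 1≤k
  ... | t′ , eq , _ = e , t′ , trans (L 1) eq , inj₁ (s , t)
  path-second-vertex u w p 1≤k | e , inj₂ (s , t , L) with onEdge-interior e k 1≤k ≤-refl
  ... | t′ , eq , _ = e , t′ , trans (L 1) eq , inj₂ (s , t)

  path-second-injective : ∀ u w w′ p p′ → path u w p 1 ≡ path u w′ p′ 1 → w ≡ w′
  path-second-injective u w w′ p p′ eq with k ≟ 0
  ... | yes refl = inj₁-injective (trans (sym (path-end u w p)) (trans eq (path-end u w′ p′)))
  ... | no k≢0 with path-second-vertex u w p (n≢0⇒n>0 k≢0) | path-second-vertex u w′ p′ (n≢0⇒n>0 k≢0)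
  ... | e , t , q , joins | e′ , t′ , q′ , joins′ with inj₂-injective (trans (sym q) (trans eq q′))
  ... | refl = Joins-functional e joins joins′

  original-neighbour : ∀ u y → SubAdj G k (inj₁ u) y → Σ[ w ∈ Vertex ] Σ[ p ∈ Adj G u w ] y ≡ path u w p 1
  original-neighbour u y (inj₁ s) with step-onEdge s
  ... | e , a , a≤k , px , py with onEdge≡inj₁ e a u (sym px)
  ... | inj₂ (N≤a , _) = ⊥-elim (1+n≰n (≤-trans N≤a a≤k))
  ... | inj₁ (refl , refl) = tgt e , edge-adj e , go (path-along (src e) (tgt e) (edge-adj e))
    where
    go : PathAlong (src e) (tgt e) (path (src e) (tgt e) (edge-adj e)) → y ≡ path (src e) (tgt e) (edge-adj e) 1
    go (e′ , inj₁ (s′ , t′ , L)) with edge-≡ e′ e s′ t′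
    ... | refl = trans py (sym (L 1))
    go (e′ , inj₂ (s′ , t′ , L)) = ⊥-elim (¬edge-reversed e′ e s′ t′)
  original-neighbour u y (inj₂ s) with step-onEdge s
  ... | e , a , a≤k , py , px with onEdge≡inj₁ e (suc a) u (sym px)
  ... | inj₁ (() , _)
  ... | inj₂ (N≤1+a , refl) with ≤-antisym a≤k (≤-pred N≤1+a)
  ... | refl = src e , Adj-sym G (edge-adj e) , go (path-along (tgt e) (src e) (Adj-sym G (edge-adj e)))
    where
    go : PathAlong (tgt e) (src e) (path (tgt e) (src e) (Adj-sym G (edge-adj e))) →
         y ≡ path (tgt e) (src e) (Adj-sym G (edge-adj e)) 1
    go (e′ , inj₁ (s′ , t′ , L)) = ⊥-elim (¬edge-reversed e′ e s′ t′)
    go (e′ , inj₂ (s′ , t′ , L)) with edge-≡ e′ e s′ t′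
    ... | refl = trans py (sym (L 1))

module Restriction (G : SimpleGraph) (k : ℕ) (v : Fin (order G)) (F : SubV G k → ℕ)
                   (D : IsGeodeticDistance (SubAdj G k) (inj₁ v) F) where
  open Subdivision G k
  open IsGeodeticDistance D

  F₀ : Vertex → ℕ
  F₀ u = F (inj₁ u)

  module _ (u w : Vertex) (p : Adj G u w) where
    private
      L = path u w p

    F-path-≤-start : ∀ a → a ≤ N → F (L 0) ≤ a + F (L a)
    F-path-≤-start zero    _     = ≤-refl
    F-path-≤-start (suc a) a<N = ≤-trans (F-path-≤-start a (≤-trans (n≤1+n a) a<N))
      (≤-trans (+-monoʳ-≤ a (adjacent-≤ _ _ (path-adjacent u w p a (≤-pred a<N)))) (≤-reflexive (+-suc a _)))

    F-path-≤-end : ∀ a → a ≤ N → F (L a) ≤ (N ∸ a) + F (L N)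
    F-path-≤-end a a≤N = subst (λ z → F (L z) ≤ (N ∸ a) + F (L N)) (m∸[m∸n]≡n a≤N) (go (N ∸ a) (m∸n≤m N a))
      where
      go : ∀ j → j ≤ N → F (L (N ∸ j)) ≤ j + F (L N)
      go zero    _     = ≤-refl
      go (suc j) j<N = ≤-trans (adjacent-≤ _ _ step-j) (s≤s (go j (≤-trans (n≤1+n j) j<N)))
        where
        step-j : SubAdj G k (L (N ∸ suc j)) (L (N ∸ j))
        step-j = subst (λ z → SubAdj G k (L (N ∸ suc j)) (L z)) (sym (m∸n≡1+[m∸1+n] N j j<N))
                (path-adjacent u w p (k ∸ j) (m∸n≤m k j))

    -- An interior vertex has only its two path neighbours, so a descent that enters the path
    -- cannot turn back: F decreases by one at every step.
    descent-continues : ∀ d a → suc a ≤ k → a + F (L a) ≡ suc d → suc a + F (L (suc a)) ≡ suc d →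
      suc (suc a) + F (L (suc (suc a))) ≡ suc d
    descent-continues d a a<k ih₀ ih₁ = go (F (L (suc a))) refl
      where
      go : ∀ m → F (L (suc a)) ≡ m → suc (suc a) + F (L (suc (suc a))) ≡ suc d
      go zero eq with path-interior u w p (suc a) (s≤s z≤n) a<k
      ... | _ , interior with trans (sym interior) (zero⇒target _ eq)
      ... | ()
      go (suc d′) eq with descent _ d′ eq
      ... | y , adj , Fy with path-neighbours u w p (suc a) y (s≤s z≤n) a<k adj
      ... | inj₁ refl = ⊥-elim (m≢1+n+m (a + d′) {1}
              (trans (subst (λ z → a + z ≡ suc d) Fy ih₀)
                     (trans (sym (subst (λ z → suc a + z ≡ suc d) eq ih₁)) (cong suc (+-suc a d′)))))
      ... | inj₂ refl = trans (cong (suc (suc a) +_) Fy)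
              (trans (sym (cong suc (+-suc a d′))) (subst (λ z → suc a + z ≡ suc d) eq ih₁))

    descent-along-path : ∀ d → F (L 0) ≡ suc d → F (L 1) ≡ d → ∀ a → a ≤ N → a + F (L a) ≡ suc d
    descent-along-path d F₀≡ F₁≡ zero          _ = F₀≡
    descent-along-path d F₀≡ F₁≡ (suc zero)    _ = cong suc F₁≡
    descent-along-path d F₀≡ F₁≡ (suc (suc a)) a+1<N = descent-continues d a (≤-pred a+1<N)
      (descent-along-path d F₀≡ F₁≡ a (≤-trans (n≤1+n _) (≤-trans (n≤1+n _) a+1<N)))
      (descent-along-path d F₀≡ F₁≡ (suc a) (≤-trans (n≤1+n _) a+1<N))

  F-path-start : ∀ u w p → F (path u w p 0) ≡ F₀ u
  F-path-start u w p = cong F (path-start u w p)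

  F-path-end : ∀ u w p → F (path u w p N) ≡ F₀ w
  F-path-end u w p = cong F (path-end u w p)

  original-descent : ∀ u d → F₀ u ≡ suc d → Σ[ w ∈ Vertex ] Σ[ p ∈ Adj G u w ] N + F₀ w ≡ suc d
  original-descent u d eq with descent (inj₁ u) d eq
  ... | y , adj , Fy with original-neighbour u y adj
  ... | w , p , refl = w , p , trans (cong (N +_) (sym (F-path-end u w p)))
                         (descent-along-path u w p d (trans (F-path-start u w p) eq) Fy N ≤-refl)

  F₀-multiple : ∀ u → ∃[ q ] F₀ u ≡ q * N
  F₀-multiple u = go (F₀ u) u ≤-refl
    where
    go : ∀ fuel u → F₀ u ≤ fuel → ∃[ q ] F₀ u ≡ q * N
    go fuel u F₀u≤fuel with F₀ u in eq
    ... | zero = 0 , refl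
    go (suc fuel) u (s≤s F₀u≤fuel) | suc d with original-descent u d eq
    ... | w , p , N+F₀w with go fuel w (≤-trans (m≤n+m (F₀ w) k) (subst (_≤ fuel) (sym (suc-injective N+F₀w)) F₀u≤fuel))
    ... | q , F₀w≡ = suc q , trans (sym N+F₀w) (cong (N +_) F₀w≡)

  dist : Vertex → ℕ
  dist u = proj₁ (F₀-multiple u)

  F₀≡dist*N : ∀ u → F₀ u ≡ dist u * N
  F₀≡dist*N u = proj₂ (F₀-multiple u)

  dist-second-vertex : ∀ u d w (p : Adj G u w) → dist u ≡ suc d → dist w ≡ d → F (path u w p 1) ≡ k + d * N
  dist-second-vertex u d w p du dw = ≤-antisym
    (subst (F (path u w p 1) ≤_) (cong (k +_) (trans (F-path-end u w p) (trans (F₀≡dist*N w) (cong (_* N) dw))))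
      (F-path-≤-end u w p 1 (s≤s z≤n)))
    (≤-pred (subst (_≤ suc (F (path u w p 1))) (trans (F-path-start u w p) (trans (F₀≡dist*N u) (cong (_* N) du)))
      (F-path-≤-start u w p 1 (s≤s z≤n))))

  isGeodeticDistance : IsGeodeticDistance (Adj G) v dist
  isGeodeticDistance = record
    { target-zero    = m*n≡0⇒m≡0 (dist v) N (trans (sym (F₀≡dist*N v)) target-zero)
    ; zero⇒target    = λ u du → inj₁-injective (zero⇒target (inj₁ u) (trans (F₀≡dist*N u) (cong (_* N) du)))
    ; adjacent-≤     = λ u w p → *-cancelʳ-≤ (dist u) (suc (dist w)) N
        (subst₂ _≤_ (trans (F-path-start u w p) (F₀≡dist*N u)) (cong (N +_) (trans (F-path-end u w p) (F₀≡dist*N w)))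
          (F-path-≤-start u w p N ≤-refl))
    ; descent        = dist-descent
    ; descent-unique = dist-descent-unique
    }
    where
    dist-descent : ∀ u d → dist u ≡ suc d → ∃[ w ] Adj G u w × dist w ≡ d
    dist-descent u d du with original-descent u (k + d * N) (trans (F₀≡dist*N u) (cong (_* N) du))
    ... | w , p , eq = w , p , *-cancelʳ-≡ (dist w) d N (trans (sym (F₀≡dist*N w)) (+-cancelˡ-≡ N _ _ eq))
    dist-descent-unique : ∀ u d w w′ → dist u ≡ suc d → Adj G u w → dist w ≡ d → Adj G u w′ → dist w′ ≡ d → w ≡ w′
    dist-descent-unique u d w w′ du p dw p′ dw′ = path-second-injective u w w′ p p′
      (descent-unique (inj₁ u) (k + d * N) _ _ (trans (F₀≡dist*N u) (cong (_* N) du))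
        (path-first-step u w p) (dist-second-vertex u d w p du dw)
        (path-first-step u w′ p′) (dist-second-vertex u d w′ p′ du dw′))

subdivision-geodetic⇒geodetic : ∀ (G : SimpleGraph) k → Geodetic (SubAdj G k) → Geodetic (Adj G)
subdivision-geodetic⇒geodetic G k geodetic = geodetic-from-distances (Adj G) λ v →
  _ , Restriction.isGeodeticDistance G k v _ (GeodeticDistance.isGeodeticDistance (SubAdj G k) geodetic (inj₁ v))

does≡true⇒ : ∀ {P : Set} (P? : Dec P) → does P? ≡ true → P
does≡true⇒ (yes p) _  = p
does≡true⇒ (no _)  ()

does≡false⇒ : ∀ {P : Set} (P? : Dec P) → does P? ≡ false → ¬ P
does≡false⇒ (yes _) ()
does≡false⇒ (no ¬p) _ = ¬p

between : ∀ α x → α ≤ x → x ≤ α + 1 → x ≡ α ⊎ x ≡ suc α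
between α x α≤x x≤α+1 with m≤n⇒m<n∨m≡n α≤x
... | inj₂ eq  = inj₁ (sym eq)
... | inj₁ α<x = inj₂ (≤-antisym (subst (x ≤_) (+-comm α 1) x≤α+1) α<x)

∣m-o∣≤1+∣1+m-o∣ : ∀ m o → ∣ m - o ∣ ≤ suc ∣ suc m - o ∣
∣m-o∣≤1+∣1+m-o∣ zero    zero    = z≤n
∣m-o∣≤1+∣1+m-o∣ zero    (suc o) = ≤-refl
∣m-o∣≤1+∣1+m-o∣ (suc m) zero    = ≤-trans (n≤1+n _) (n≤1+n _)
∣m-o∣≤1+∣1+m-o∣ (suc m) (suc o) = ∣m-o∣≤1+∣1+m-o∣ m o

∣1+m-o∣≤1+∣m-o∣ : ∀ m o → ∣ suc m - o ∣ ≤ suc ∣ m - o ∣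
∣1+m-o∣≤1+∣m-o∣ zero    zero    = ≤-refl
∣1+m-o∣≤1+∣m-o∣ zero    (suc o) = ≤-trans (n≤1+n o) (n≤1+n _)
∣1+m-o∣≤1+∣m-o∣ (suc m) zero    = ≤-refl
∣1+m-o∣≤1+∣m-o∣ (suc m) (suc o) = ∣1+m-o∣≤1+∣m-o∣ m o

∣m-o∣-descent : ∀ m o d → ∣ m - o ∣ ≡ suc d → ∣ pred m - o ∣ ≡ d ⊎ ∣ suc m - o ∣ ≡ d
∣m-o∣-descent zero          (suc o)          d eq   = inj₂ (suc-injective eq)
∣m-o∣-descent (suc m)       zero             d eq   = inj₁ (trans (∣-∣-identityʳ m) (suc-injective eq))
∣m-o∣-descent (suc zero)    (suc .(suc d))   d refl = inj₂ refl
∣m-o∣-descent (suc (suc m)) (suc o)          d eq   = ∣m-o∣-descent (suc m) o d eq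

∣m-o∣-no-peak : ∀ m o d → ∣ m - o ∣ ≡ d → ∣ suc (suc m) - o ∣ ≡ d → ∣ suc m - o ∣ ≢ suc d
∣m-o∣-no-peak m       zero    d e₀ e₂ _  = m≢1+n+m m {1} (trans (trans (sym (∣-∣-identityʳ m)) e₀) (sym e₂))
∣m-o∣-no-peak zero    (suc o) d e₀ _  e₁ = m≢1+n+m o {1} (trans e₁ (cong suc (sym e₀)))
∣m-o∣-no-peak (suc m) (suc o) d e₀ e₂ e₁ = ∣m-o∣-no-peak m o d e₀ e₂ e₁

⊓-step-≤ : ∀ m n → m ⊓ suc n ≤ suc (suc m ⊓ n) × suc m ⊓ n ≤ suc (m ⊓ suc n)
⊓-step-≤ m n = ⊓-mono-≤ (≤-trans (n≤1+n m) (n≤1+n _)) ≤-refl , ⊓-mono-≤ ≤-refl (≤-trans (n≤1+n n) (n≤1+n _))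

⊓-descent : ∀ m n d → suc m ⊓ suc n ≡ suc d → m ⊓ suc (suc n) ≡ d ⊎ suc (suc m) ⊓ n ≡ d
⊓-descent m n d eq with ≤-total m n
... | inj₁ m≤n = inj₁ (trans (m≤n⇒m⊓n≡m (≤-trans m≤n (≤-trans (n≤1+n n) (n≤1+n _))))
                             (trans (sym (m≤n⇒m⊓n≡m m≤n)) (suc-injective eq)))
... | inj₂ n≤m = inj₂ (trans (m≥n⇒m⊓n≡n (≤-trans n≤m (≤-trans (n≤1+n m) (n≤1+n _))))
                             (trans (sym (m≥n⇒m⊓n≡n n≤m)) (suc-injective eq)))

⊓-peak⇒≡ : ∀ m n d → m ⊓ suc (suc n) ≡ d → suc (suc m) ⊓ n ≡ d → suc m ⊓ suc n ≡ suc d → m ≡ n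
⊓-peak⇒≡ m n d e₀ e₂ e₁ with ≤-total m n
... | inj₁ m≤n with ⊓-sel (suc (suc m)) n
...   | inj₁ s = ⊥-elim (m≢1+n+m m {1} (trans m≡d (sym (trans (sym s) e₂))))
  where m≡d = trans (sym (m≤n⇒m⊓n≡m m≤n)) (suc-injective e₁)
...   | inj₂ s = trans (trans (sym (m≤n⇒m⊓n≡m m≤n)) (suc-injective e₁)) (sym (trans (sym s) e₂))
⊓-peak⇒≡ m n d e₀ e₂ e₁ | inj₂ n≤m with ⊓-sel m (suc (suc n))
...   | inj₁ s = trans (trans (sym s) e₀) (sym (trans (sym (m≥n⇒m⊓n≡n n≤m)) (suc-injective e₁)))
...   | inj₂ s = ⊥-elim (m≢1+n+m n {1} (trans n≡d (sym (trans (sym s) e₀))))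
  where n≡d = trans (sym (m≥n⇒m⊓n≡n n≤m)) (suc-injective e₁)

-- A candidate distance φ on the original vertices extends to all of G(k): on the special edges
-- (those containing the target) it is the distance |a - φ u| to the target along the edge,
-- elsewhere the shorter way out through one of the two ends.
module Extension (G : SimpleGraph) (k : ℕ) (φ : Fin (order G) → ℕ) (special : Fin (order G) → Fin (order G) → Bool) where
  open Subdivision G k

  throughEnds : ℕ → ℕ → ℕ → ℕ
  throughEnds X Y a = (a + X) ⊓ ((N ∸ a) + Y)

  profileᵇ : Bool → Vertex → Vertex → ℕ → ℕ
  profileᵇ true  u w a = ∣ a - φ u ∣
  profileᵇ false u w a = throughEnds (φ u) (φ w) a

  profile : Vertex → Vertex → ℕ → ℕ
  profile u w = profileᵇ (special u w) u w

  extend : SubV G k → ℕ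
  extend (inj₁ u)       = φ u
  extend (inj₂ (e , t)) = profile (src e) (tgt e) (suc (toℕ t))

  record Conditions (τ : SubV G k) : Set where
    field
      special-sym             : ∀ u w → special u w ≡ special w u
      φ-adjacent-≤            : ∀ u w → Adj G u w → special u w ≡ false → φ u ≤ N + φ w
      special-sum             : ∀ u w → Adj G u w → special u w ≡ true → φ u + φ w ≡ N
      no-tie                  : ∀ u w → Adj G u w → special u w ≡ false → ∀ a → 1 ≤ a → a ≤ k →
                                  a + φ u ≢ (N ∸ a) + φ w
      original-descent        : ∀ u d → φ u ≡ suc d → Σ[ w ∈ Vertex ] Σ[ p ∈ Adj G u w ] profile u w 1 ≡ d
      original-descent-unique : ∀ u d w w′ → Adj G u w → Adj G u w′ → φ u ≡ suc d →
                                  profile u w 1 ≡ d → profile u w′ 1 ≡ d → w ≡ w′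
      extend-target-zero      : extend τ ≡ 0
      extend-zero⇒target      : ∀ y → extend y ≡ 0 → y ≡ τ

  throughEnds-at : ∀ X Y a → suc a ≤ k → throughEnds X Y a ≡ (a + X) ⊓ suc (suc ((k ∸ suc a) + Y))
  throughEnds-at X Y a a<k = cong (λ z → (a + X) ⊓ (z + Y))
    (trans (+-∸-assoc 1 (≤-trans (n≤1+n a) a<k)) (cong suc (m∸n≡1+[m∸1+n] k a a<k)))

  throughEnds-at-suc : ∀ X Y a → suc a ≤ k → throughEnds X Y (suc a) ≡ suc (a + X) ⊓ suc ((k ∸ suc a) + Y)
  throughEnds-at-suc X Y a a<k = cong (λ z → suc (a + X) ⊓ (z + Y)) (m∸n≡1+[m∸1+n] k a a<k)

  ∣a-B∣-reversed : ∀ a a′ B B′ → a + a′ ≡ N → B + B′ ≡ N → ∣ a′ - B′ ∣ ≡ ∣ a - B ∣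
  ∣a-B∣-reversed a a′ B B′ aa′ BB′ = begin
    ∣ a′ - B′ ∣                  ≡⟨ ∣m+n-m+o∣≡∣n-o∣ (a + B) a′ B′ ⟨
    ∣ a + B + a′ - a + B + B′ ∣  ≡⟨ cong₂ ∣_-_∣ (rearrange a B a′) (+-assoc a B B′) ⟩
    ∣ B + (a + a′) - a + (B + B′) ∣ ≡⟨ cong₂ (λ x y → ∣ B + x - a + y ∣) aa′ BB′ ⟩
    ∣ B + N - a + N ∣            ≡⟨ cong₂ ∣_-_∣ (+-comm B N) (+-comm a N) ⟩
    ∣ N + B - N + a ∣            ≡⟨ ∣m+n-m+o∣≡∣n-o∣ N B a ⟩
    ∣ B - a ∣                    ≡⟨ ∣-∣-comm B a ⟩
    ∣ a - B ∣                    ∎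
    where
    open ≡-Reasoning
    rearrange : ∀ a B a′ → a + B + a′ ≡ B + (a + a′)
    rearrange = solve-∀

  profile-interior-nonzero : ∀ u w a → special u w ≡ false → 1 ≤ a → a ≤ k → profile u w a ≢ 0
  profile-interior-nonzero u w (suc a) sp _ a<k eq
    rewrite sp | m∸n≡1+[m∸1+n] k a a<k with eq
  ... | ()

  second-vertex-descent : ∀ u w d → special u w ≡ false → φ u ≡ suc d → profile u w 1 ≡ d → N + φ w ≡ φ u
  second-vertex-descent u w d sp φu eq rewrite sp with ⊓-sel (suc (φ u)) (k + φ w)
  ... | inj₁ s = ⊥-elim (m≢1+n+m d {1} (sym (trans (cong suc (sym φu)) (trans (sym s) eq))))
  ... | inj₂ s = trans (cong suc (trans (sym s) eq)) (sym φu)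

  descent-second-vertex : ∀ u w d → special u w ≡ false → φ u ≡ suc d → N + φ w ≡ φ u → profile u w 1 ≡ d
  descent-second-vertex u w d sp φu eq rewrite sp =
    trans (m≥n⇒m⊓n≡n (≤-trans (n≤1+n _) (≤-trans (≤-reflexive eq) (n≤1+n _)))) (suc-injective (trans eq φu))

  module _ {τ : SubV G k} (C : Conditions τ) where
    open Conditions C

    profile-start : ∀ u w → Adj G u w → profile u w 0 ≡ φ u
    profile-start u w p = go (special u w) refl
      where
      go : ∀ b → special u w ≡ b → profileᵇ b u w 0 ≡ φ u
      go true  _  = refl
      go false sp = m≤n⇒m⊓n≡m (φ-adjacent-≤ u w p sp)

    profile-end : ∀ u w → Adj G u w → profile u w N ≡ φ w
    profile-end u w p = go (special u w) refl
      where
      go : ∀ b → special u w ≡ b → profileᵇ b u w N ≡ φ w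
      go true  sp = trans (cong (λ z → ∣ z - φ u ∣) (sym (special-sum u w p sp)))
                      (trans (∣-∣-comm (φ u + φ w) (φ u)) (∣m-m+n∣≡n (φ u) (φ w)))
      go false sp = trans (cong (λ z → (N + φ u) ⊓ (z + φ w)) (n∸n≡0 N))
                      (m≥n⇒m⊓n≡n (φ-adjacent-≤ w u (Adj-sym G p) (trans (special-sym w u) sp)))

    profile-reversed : ∀ u w a → a ≤ N → Adj G u w → profile w u (N ∸ a) ≡ profile u w a
    profile-reversed u w a a≤N p = go (special u w) refl
      where
      go : ∀ b → special u w ≡ b → profileᵇ (special w u) w u (N ∸ a) ≡ profileᵇ b u w a
      go true sp rewrite sym (special-sym u w) | sp =
        ∣a-B∣-reversed a (N ∸ a) (φ u) (φ w) (trans (+-comm a (N ∸ a)) (m∸n+n≡m a≤N)) (special-sum u w p sp)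
      go false sp rewrite sym (special-sym u w) | sp =
        trans (cong (λ z → ((N ∸ a) + φ w) ⊓ (z + φ u)) (m∸[m∸n]≡n a≤N)) (⊓-comm _ _)

    extend-onEdge : ∀ e a → a ≤ N → extend (onEdge e a) ≡ profile (src e) (tgt e) a
    extend-onEdge e zero    _ = sym (profile-start (src e) (tgt e) (edge-adj e))
    extend-onEdge e (suc a) a<N with m≤n⇒m<n∨m≡n a<N
    ... | inj₁ a+1<N with onEdge-interior e (suc a) (s≤s z≤n) (≤-pred a+1<N)
    ...   | t , eq , refl rewrite eq = refl
    extend-onEdge e (suc a) _ | inj₂ refl =
      trans (cong extend (onEdge-N e)) (sym (profile-end (src e) (tgt e) (edge-adj e)))

    extend-path : ∀ u w p a → a ≤ N → extend (path u w p a) ≡ profile u w a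
    extend-path u w p a a≤N with path-along u w p
    ... | e , inj₁ (refl , refl , L) = trans (cong extend (L a)) (extend-onEdge e a a≤N)
    ... | e , inj₂ (refl , refl , L) = trans (cong extend (L a))
            (trans (extend-onEdge e (N ∸ a) (m∸n≤m N a)) (profile-reversed u w a a≤N p))

    profile-step-≤ : ∀ u w a → a ≤ k →
      profile u w a ≤ suc (profile u w (suc a)) × profile u w (suc a) ≤ suc (profile u w a)
    profile-step-≤ u w a a≤k = go (special u w)
      where
      go : ∀ b → profileᵇ b u w a ≤ suc (profileᵇ b u w (suc a)) × profileᵇ b u w (suc a) ≤ suc (profileᵇ b u w a)
      go true = ∣m-o∣≤1+∣1+m-o∣ a (φ u) , ∣1+m-o∣≤1+∣m-o∣ a (φ u)
      go false rewrite cong (λ z → (a + φ u) ⊓ (z + φ w)) (+-∸-assoc 1 a≤k) = ⊓-step-≤ (a + φ u) ((k ∸ a) + φ w)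

    profile-descent : ∀ u w a d → 1 ≤ a → a ≤ k → profile u w a ≡ suc d →
      profile u w (pred a) ≡ d ⊎ profile u w (suc a) ≡ d
    profile-descent u w (suc a) d _ a<k eq = go (special u w) eq
      where
      go : ∀ b → profileᵇ b u w (suc a) ≡ suc d → profileᵇ b u w a ≡ d ⊎ profileᵇ b u w (suc (suc a)) ≡ d
      go true  e = ∣m-o∣-descent (suc a) (φ u) d e
      go false e rewrite throughEnds-at (φ u) (φ w) a a<k =
        ⊓-descent (a + φ u) ((k ∸ suc a) + φ w) d (trans (sym (throughEnds-at-suc (φ u) (φ w) a a<k)) e)

    profile-no-peak : ∀ u w a d → Adj G u w → 1 ≤ a → a ≤ k →
      profile u w (pred a) ≡ d → profile u w (suc a) ≡ d → profile u w a ≢ suc d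
    profile-no-peak u w (suc a) d p _ a<k = go (special u w) refl
      where
      go : ∀ b → special u w ≡ b → profileᵇ b u w a ≡ d → profileᵇ b u w (suc (suc a)) ≡ d →
           profileᵇ b u w (suc a) ≢ suc d
      go true  _  e₀ e₂ e₁ = ∣m-o∣-no-peak a (φ u) d e₀ e₂ e₁
      go false sp e₀ e₂ e₁ = no-tie u w p sp (suc a) (s≤s z≤n) a<k
        (trans (cong suc tie) (sym (cong (_+ φ w) (m∸n≡1+[m∸1+n] k a a<k))))
        where
        tie : a + φ u ≡ (k ∸ suc a) + φ w
        tie = ⊓-peak⇒≡ (a + φ u) ((k ∸ suc a) + φ w) d (trans (sym (throughEnds-at (φ u) (φ w) a a<k)) e₀) e₂
                (trans (sym (throughEnds-at-suc (φ u) (φ w) a a<k)) e₁)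

    extend-adjacent-≤ : ∀ x y → SubAdj G k x y → extend x ≤ suc (extend y)
    extend-adjacent-≤ x y (inj₁ s) with step-onEdge s
    ... | e , a , a≤k , refl , refl =
      subst₂ (λ p q → p ≤ suc q) (sym (extend-onEdge e a (≤-trans a≤k (n≤1+n k)))) (sym (extend-onEdge e (suc a) (s≤s a≤k)))
        (proj₁ (profile-step-≤ (src e) (tgt e) a a≤k))
    extend-adjacent-≤ x y (inj₂ s) with step-onEdge s
    ... | e , a , a≤k , refl , refl =
      subst₂ (λ p q → p ≤ suc q) (sym (extend-onEdge e (suc a) (s≤s a≤k))) (sym (extend-onEdge e a (≤-trans a≤k (n≤1+n k))))
        (proj₂ (profile-step-≤ (src e) (tgt e) a a≤k))

    extend-descent : ∀ x d → extend x ≡ suc d → ∃[ y ] SubAdj G k x y × extend y ≡ d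
    extend-descent (inj₁ u) d eq with original-descent u d eq
    ... | w , p , pr = path u w p 1 , path-first-step u w p , trans (extend-path u w p 1 (s≤s z≤n)) pr
    extend-descent (inj₂ (e , t)) d eq
      with profile-descent (src e) (tgt e) (suc (toℕ t)) d (s≤s z≤n) (Fin.toℕ<n t) eq
    ... | inj₁ r = onEdge e (toℕ t) ,
          inj₂ (subst (Step G k (onEdge e (toℕ t))) (onEdge-inner e t) (onEdge-step e (toℕ t) (≤-trans (n≤1+n _) t<k))) ,
          trans (extend-onEdge e (toℕ t) (≤-trans (n≤1+n _) (≤-trans t<k (n≤1+n k)))) r
      where t<k = Fin.toℕ<n t
    ... | inj₂ r = onEdge e (suc (suc (toℕ t))) ,
          subst (λ z → SubAdj G k z (onEdge e (suc (suc (toℕ t))))) (onEdge-inner e t) (inj₁ (onEdge-step e (suc (toℕ t)) t<k)) ,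
          trans (extend-onEdge e (suc (suc (toℕ t))) (s≤s t<k)) r
      where t<k = Fin.toℕ<n t

    extend-descent-unique : ∀ x d y y′ → extend x ≡ suc d → SubAdj G k x y → extend y ≡ d →
      SubAdj G k x y′ → extend y′ ≡ d → y ≡ y′
    extend-descent-unique (inj₁ u) d y y′ eq x~y ey x~y′ ey′
      with original-neighbour u y x~y | original-neighbour u y′ x~y′
    ... | w , p , refl | w′ , p′ , refl
      with original-descent-unique u d w w′ p p′ eq
             (trans (sym (extend-path u w p 1 (s≤s z≤n))) ey) (trans (sym (extend-path u w′ p′ 1 (s≤s z≤n))) ey′)
    ... | refl = cong (λ z → path u w z 1) (T-irrelevant p p′)
    extend-descent-unique (inj₂ (e , t)) d y y′ eq x~y ey x~y′ ey′ =
      go (onEdge-neighbours e a y (s≤s z≤n) a≤k (subst (λ z → SubAdj G k z y) (sym (onEdge-inner e t)) x~y))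
         (onEdge-neighbours e a y′ (s≤s z≤n) a≤k (subst (λ z → SubAdj G k z y′) (sym (onEdge-inner e t)) x~y′))
      where
      a = suc (toℕ t)
      a≤k : a ≤ k
      a≤k = Fin.toℕ<n t
      before : ∀ z → z ≡ onEdge e (pred a) → extend z ≡ d → profile (src e) (tgt e) (pred a) ≡ d
      before z refl ez = trans (sym (extend-onEdge e (pred a) (≤-trans (n≤1+n _) (≤-trans a≤k (n≤1+n k))))) ez
      after : ∀ z → z ≡ onEdge e (suc a) → extend z ≡ d → profile (src e) (tgt e) (suc a) ≡ d
      after z refl ez = trans (sym (extend-onEdge e (suc a) (s≤s a≤k))) ez
      no-peak : profile (src e) (tgt e) (pred a) ≡ d → profile (src e) (tgt e) (suc a) ≡ d → ⊥
      no-peak e₀ e₂ = profile-no-peak (src e) (tgt e) a d (edge-adj e) (s≤s z≤n) a≤k e₀ e₂ eq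
      go : y ≡ onEdge e (pred a) ⊎ y ≡ onEdge e (suc a) → y′ ≡ onEdge e (pred a) ⊎ y′ ≡ onEdge e (suc a) → y ≡ y′
      go (inj₁ q) (inj₁ q′) = trans q (sym q′)
      go (inj₂ q) (inj₂ q′) = trans q (sym q′)
      go (inj₁ q) (inj₂ q′) = ⊥-elim (no-peak (before y q ey) (after y′ q′ ey′))
      go (inj₂ q) (inj₁ q′) = ⊥-elim (no-peak (before y′ q′ ey′) (after y q ey))

    extend-isGeodeticDistance : IsGeodeticDistance (SubAdj G k) τ extend
    extend-isGeodeticDistance = record
      { target-zero    = extend-target-zero
      ; zero⇒target    = extend-zero⇒target
      ; adjacent-≤     = extend-adjacent-≤
      ; descent        = extend-descent
      ; descent-unique = extend-descent-unique
      }

double≢odd : ∀ x y → x + x ≢ suc (y + y)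
double≢odd x y eq = even≢odd x y (trans (cong (x +_) (+-identityʳ x)) (trans eq (cong (λ z → suc (y + z)) (sym (+-identityʳ y)))))

double-injective : ∀ x y → x + x ≡ y + y → x ≡ y
double-injective x y eq = *-cancelˡ-≡ x y 2 (trans (cong (x +_) (+-identityʳ x)) (trans eq (cong (y +_) (sym (+-identityʳ y)))))

<⇒∃offset : ∀ {p q} → p < q → ∃[ r ] q ≡ p + suc r
<⇒∃offset {zero}  {suc q} _         = q , refl
<⇒∃offset {suc p} {suc q} (s≤s p<q) with <⇒∃offset p<q
... | r , eq = r , cong suc eq

module OddModulus (m : ℕ) where

  N : ℕ
  N = suc (m + m)

  ¬double-gap : ∀ x y p r → x < N → x + x + p * N ≢ y + y + (p + suc r) * N
  ¬double-gap x y p r x<N eq = go r (+-cancelʳ-≡ (p * N) _ _ (trans eq (split y p r m)))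
    where
    split : ∀ y p r m → y + y + (p + suc r) * suc (m + m) ≡ y + y + (suc (m + m) + r * suc (m + m)) + p * suc (m + m)
    split = solve-∀
    odd : ∀ y m → y + y + (suc (m + m) + 0 * suc (m + m)) ≡ suc ((y + m) + (y + m))
    odd = solve-∀
    regroup : ∀ y r m → y + y + (suc (m + m) + suc r * suc (m + m)) ≡ (y + y) + (suc (m + m) + suc (m + m) + r * suc (m + m))
    regroup = solve-∀
    go : ∀ r → x + x ≢ y + y + (N + r * N)
    go zero    e = double≢odd x (y + m) (trans e (odd y m))
    go (suc r) e = <-irrefl refl (≤-trans (+-mono-< x<N x<N) (subst (N + N ≤_) (sym e) 2N≤))
      where
      2N≤ : N + N ≤ y + y + (N + suc r * N)
      2N≤ = subst (N + N ≤_) (sym (regroup y r m)) (≤-trans (m≤m+n (N + N) (r * N)) (m≤n+m _ (y + y)))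

  double-residue-injective : ∀ x y p q → x < N → y < N → x + x + p * N ≡ y + y + q * N → x ≡ y × p ≡ q
  double-residue-injective x y p q x<N y<N eq with <-cmp p q
  ... | tri< p<q _ _ with <⇒∃offset p<q
  ...   | r , refl = ⊥-elim (¬double-gap x y p r x<N eq)
  double-residue-injective x y p q x<N y<N eq | tri> _ _ q<p with <⇒∃offset q<p
  ...   | r , refl = ⊥-elim (¬double-gap y x q r y<N (sym eq))
  double-residue-injective x y p q x<N y<N eq | tri≈ _ refl _ =
    double-injective x y (+-cancelʳ-≡ (p * N) _ _ eq) , refl

  no-tie-same-residue : ∀ a a′ s p q → a + a′ ≡ N → 1 ≤ a → a < N → a + (s + p * N) ≢ a′ + (s + q * N)
  no-tie-same-residue a a′ s p q aa′ 1≤a a<N eq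
    with double-residue-injective a 0 p (suc q) a<N (s≤s z≤n)
           (+-cancelˡ-≡ s _ _ (trans (sym (lhs a s p N)) (trans (cong (a +_) eq) (trans (rhs a a′ s q N)
             (cong (λ z → s + (z + q * N)) aa′)))))
    where
    lhs : ∀ a s p n → a + (a + (s + p * n)) ≡ s + (a + a + p * n)
    lhs = solve-∀
    rhs : ∀ a a′ s q n → a + (a′ + (s + q * n)) ≡ s + ((a + a′) + q * n)
    rhs = solve-∀
  no-tie-same-residue a a′ s p q aa′ () a<N eq | refl , _

  tie-complementary-residues : ∀ a a′ s s′ p q → a + a′ ≡ N → s + s′ ≡ N → a < N → s′ < N →
    a + (s + p * N) ≡ a′ + (s′ + q * N) → a ≡ s′ × p ≡ q
  tie-complementary-residues a a′ s s′ p q aa′ ss′ a<N s′<N eq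
    with double-residue-injective a s′ (suc p) (suc q) a<N s′<N
           (trans (cong (λ z → a + a + (z + p * N)) (sym ss′))
           (trans (sym (lhs a s s′ p N)) (trans (cong ((a + s′) +_) eq)
           (trans (rhs a a′ s′ q N) (cong (λ z → s′ + s′ + (z + q * N)) aa′)))))
    where
    lhs : ∀ a s s′ p n → (a + s′) + (a + (s + p * n)) ≡ a + a + ((s + s′) + p * n)
    lhs = solve-∀
    rhs : ∀ a a′ s′ q n → (a + s′) + (a′ + (s′ + q * n)) ≡ s′ + s′ + ((a + a′) + q * n)
    rhs = solve-∀
  ... | a≡s′ , p≡q = a≡s′ , suc-injective p≡q

  complementary-residues-distinct : ∀ s s′ p q → s + s′ ≡ N → 1 ≤ s → s < N → s + p * N ≢ s′ + q * N
  complementary-residues-distinct s s′ p q ss′ 1≤s s<N eq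
    with double-residue-injective s 0 p (suc q) s<N (s≤s z≤n)
           (trans (+-assoc s s (p * N)) (trans (cong (s +_) eq)
           (trans (sym (+-assoc s s′ (q * N))) (cong (_+ q * N) ss′))))
  complementary-residues-distinct s s′ p q ss′ () s<N eq | refl , _

  complements-distinct : ∀ b c → b + c ≡ N → b ≢ c
  complements-distinct b .b eq refl = double≢odd b m eq

module MixedTie (m : ℕ) {V : Set} (A : V → V → Set) (A-sym : ∀ {x y} → A x y → A y x) where
  open OddModulus m

  residue-≤⇒quotient-≤ : ∀ s₁ s₂ α β → s₂ < N → s₁ + α * N ≤ s₂ + β * N → α ≤ β
  residue-≤⇒quotient-≤ s₁ s₂ α β s₂<N le = ≮⇒≥ λ β<α → 1+n≰n
    (≤-trans (+-monoˡ-≤ (β * N) s₂<N) (≤-trans (*-monoˡ-≤ N β<α) (≤-trans (m≤n+m (α * N) s₁) le)))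

  -- The tie forces g₁ u = g₂ w = α; by the triangle inequality g₂ u and g₁ w are α or α + 1, and each
  -- case is either an instance of crossing-edge or would make the complementary residues s₁, s₂ equal.
  tie⇒centres : ∀ {x₁ x₂ g₁ g₂} → IsGeodeticDistance A x₁ g₁ → IsGeodeticDistance A x₂ g₂ →
    g₂ x₁ ≤ 1 → g₁ x₂ ≤ 1 → ∀ s₁ s₂ → s₁ + s₂ ≡ N → s₁ < N → s₂ < N →
    ∀ u w a → A u w → a < N → a + (s₁ + g₁ u * N) ≡ (N ∸ a) + (s₂ + g₂ w * N) →
    s₁ + g₁ u * N ≤ s₂ + g₂ u * N → s₂ + g₂ w * N ≤ s₁ + g₁ w * N → u ≡ x₁ × w ≡ x₂
  tie⇒centres {x₁} {x₂} {g₁} {g₂} D₁ D₂ x₁x₂≤1 x₂x₁≤1 s₁ s₂ s₁s₂ s₁<N s₂<N u w a u~w a<N tie min-u min-w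
    with tie-complementary-residues a (N ∸ a) s₁ s₂ (g₁ u) (g₂ w) (m+[n∸m]≡n (≤-trans (n≤1+n a) a<N)) s₁s₂ a<N s₂<N tie
  ... | _ , g₁u≡g₂w = go (between α (g₂ u) α≤g₂u g₂u≤α+1) (between α (g₁ w) α≤g₁w g₁w≤α+1)
    where
    α = g₁ u
    g₂w≡α : g₂ w ≡ α
    g₂w≡α = sym g₁u≡g₂w
    α≤g₂u : α ≤ g₂ u
    α≤g₂u = residue-≤⇒quotient-≤ s₁ s₂ α (g₂ u) s₂<N min-u
    g₂u≤α+1 : g₂ u ≤ α + 1
    g₂u≤α+1 = ≤-trans (distance-triangle D₁ D₂ u) (+-monoʳ-≤ α x₁x₂≤1)
    α≤g₁w : α ≤ g₁ w
    α≤g₁w = subst (_≤ g₁ w) g₂w≡α (residue-≤⇒quotient-≤ s₂ s₁ (g₂ w) (g₁ w) s₁<N min-w)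
    g₁w≤α+1 : g₁ w ≤ α + 1
    g₁w≤α+1 = ≤-trans (distance-triangle D₂ D₁ w) (subst (λ z → z + g₁ x₂ ≤ α + 1) (sym g₂w≡α) (+-monoʳ-≤ α x₂x₁≤1))
    go : g₂ u ≡ α ⊎ g₂ u ≡ suc α → g₁ w ≡ α ⊎ g₁ w ≡ suc α → u ≡ x₁ × w ≡ x₂
    go (inj₂ g₂u) _ = crossing-edge D₁ D₂ x₁x₂≤1 α u w u~w refl g₂w≡α g₂u α≤g₁w
    go (inj₁ g₂u) (inj₂ g₁w) with crossing-edge D₂ D₁ x₂x₁≤1 α w u (A-sym u~w) g₂w≡α refl g₁w (≤-reflexive (sym g₂u))
    ... | w≡x₂ , u≡x₁ = u≡x₁ , w≡x₂
    go (inj₁ g₂u) (inj₁ g₁w) = ⊥-elim (complements-distinct s₁ s₂ s₁s₂ (≤-antisym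
      (+-cancelʳ-≤ (α * N) s₁ s₂ (subst (λ z → s₁ + α * N ≤ s₂ + z * N) g₂u min-u))
      (+-cancelʳ-≤ (α * N) s₂ s₁ (subst₂ (λ z z′ → s₂ + z * N ≤ s₁ + z′ * N) g₂w≡α g₁w min-w))))

module OriginalTarget (G : SimpleGraph) (m : ℕ) (v : Fin (order G)) (f : Fin (order G) → ℕ)
                      (D : IsGeodeticDistance (Adj G) v f) where
  open Subdivision G (m + m)
  open OddModulus m using (no-tie-same-residue)
  open IsGeodeticDistance D

  φ : Vertex → ℕ
  φ u = f u * N

  open Extension G (m + m) φ (λ _ _ → false)

  φ≡suc⇒f≡suc : ∀ u d → φ u ≡ suc d → ∃[ d′ ] f u ≡ suc d′ × φ u ≡ N + d′ * N
  φ≡suc⇒f≡suc u d eq with f u in fu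
  ... | suc d′ = d′ , refl , refl
  φ≡suc⇒f≡suc u d () | zero

  N+φ≡φ⇒f≡pred : ∀ u w d′ → f u ≡ suc d′ → N + φ w ≡ φ u → f w ≡ d′
  N+φ≡φ⇒f≡pred u w d′ fu eq = suc-injective (*-cancelʳ-≡ (suc (f w)) (suc d′) N (trans eq (cong (_* N) fu)))

  conditions : Conditions (inj₁ v)
  conditions = record
    { special-sym             = λ _ _ → refl
    ; φ-adjacent-≤            = λ u w p _ → *-monoˡ-≤ N (adjacent-≤ u w p)
    ; special-sum             = λ _ _ _ ()
    ; no-tie                  = λ u w _ _ a 1≤a a≤k →
        no-tie-same-residue a (N ∸ a) 0 (f u) (f w) (m+[n∸m]≡n (≤-trans a≤k (n≤1+n _))) 1≤a (s≤s a≤k)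
    ; original-descent        = φ-descent
    ; original-descent-unique = φ-descent-unique
    ; extend-target-zero      = cong (_* N) target-zero
    ; extend-zero⇒target      = extend-zero⇒v
    }
    where
    φ-descent : ∀ u d → φ u ≡ suc d → Σ[ w ∈ Vertex ] Σ[ p ∈ Adj G u w ] profile u w 1 ≡ d
    φ-descent u d eq with φ≡suc⇒f≡suc u d eq
    ... | d′ , fu , φu with descent u d′ fu
    ... | w , p , fw = w , p , descent-second-vertex u w d refl eq (trans (cong (λ z → N + z * N) fw) (sym φu))

    φ-descent-unique : ∀ u d w w′ → Adj G u w → Adj G u w′ → φ u ≡ suc d →
      profile u w 1 ≡ d → profile u w′ 1 ≡ d → w ≡ w′
    φ-descent-unique u d w w′ p p′ eq pr pr′ with φ≡suc⇒f≡suc u d eq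
    ... | d′ , fu , _ = descent-unique u d′ w w′ fu
      p  (N+φ≡φ⇒f≡pred u w  d′ fu (second-vertex-descent u w  d refl eq pr))
      p′ (N+φ≡φ⇒f≡pred u w′ d′ fu (second-vertex-descent u w′ d refl eq pr′))

    extend-zero⇒v : ∀ y → extend y ≡ 0 → y ≡ inj₁ v
    extend-zero⇒v (inj₁ u) eq = cong inj₁ (zero⇒target u (m*n≡0⇒m≡0 (f u) N eq))
    extend-zero⇒v (inj₂ (e , t)) eq =
      ⊥-elim (profile-interior-nonzero (src e) (tgt e) (suc (toℕ t)) refl (s≤s z≤n) (Fin.toℕ<n t) eq)

  isGeodeticDistance : IsGeodeticDistance (SubAdj G (m + m)) (inj₁ v) extend
  isGeodeticDistance = extend-isGeodeticDistance conditions

module InteriorTarget (G : SimpleGraph) (m : ℕ) (e₀ : Edge G) (t₀ : Fin (m + m)) where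
  open Subdivision G (m + m)
  open OddModulus m using (no-tie-same-residue; complementary-residues-distinct)

  k : ℕ
  k = m + m

  i₀ j₀ : Vertex
  i₀ = src e₀
  j₀ = tgt e₀

  -- The target inj₂ (e₀ , t₀) lies at distance b from i₀ and c from j₀ along e₀.
  b c : ℕ
  b = suc (toℕ t₀)
  c = k ∸ toℕ t₀

  t₀<k : toℕ t₀ < k
  t₀<k = Fin.toℕ<n t₀

  b+c≡N : b + c ≡ N
  b+c≡N = cong suc (m+[n∸m]≡n (≤-trans (n≤1+n _) t₀<k))

  c+b≡N : c + b ≡ N
  c+b≡N = trans (+-comm c b) b+c≡N

  b<N : b < N
  b<N = s≤s t₀<k

  1≤c : 1 ≤ c
  1≤c = subst (1 ≤_) (sym (m∸n≡1+[m∸1+n] k (toℕ t₀) t₀<k)) (s≤s z≤n)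

  c<N : c < N
  c<N = s≤s (m∸n≤m k (toℕ t₀))

  Joins? : ∀ u w → Dec (Joins e₀ u w)
  Joins? u w = ((i₀ Fin.≟ u) ×-dec (j₀ Fin.≟ w)) ⊎-dec ((i₀ Fin.≟ w) ×-dec (j₀ Fin.≟ u))

  special : Vertex → Vertex → Bool
  special u w = does (Joins? u w)

  special⇒Joins : ∀ {u w} → special u w ≡ true → Joins e₀ u w
  special⇒Joins {u} {w} = does≡true⇒ (Joins? u w)

  module _ {f₁ f₂ : Vertex → ℕ} (D₁ : IsGeodeticDistance (Adj G) i₀ f₁) (D₂ : IsGeodeticDistance (Adj G) j₀ f₂) where
    open IsGeodeticDistance

    viaᵢ viaⱼ φ : Vertex → ℕ
    viaᵢ u = b + f₁ u * N
    viaⱼ u = c + f₂ u * N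
    φ u = viaᵢ u ⊓ viaⱼ u

    open Extension G k φ special

    f₂-i₀ : f₂ i₀ ≡ 1
    f₂-i₀ = adjacent-distance-one D₂ i₀ (edge-adj e₀) (src≢tgt e₀)

    f₁-j₀ : f₁ j₀ ≡ 1
    f₁-j₀ = adjacent-distance-one D₁ j₀ (Adj-sym G (edge-adj e₀)) (λ eq → src≢tgt e₀ (sym eq))

    viaᵢ-i₀ : viaᵢ i₀ ≡ b
    viaᵢ-i₀ = trans (cong (λ z → b + z * N) (target-zero D₁)) (+-identityʳ b)

    viaⱼ-i₀ : viaⱼ i₀ ≡ c + N
    viaⱼ-i₀ = trans (cong (λ z → c + z * N) f₂-i₀) (cong (c +_) (+-identityʳ N))

    viaⱼ-j₀ : viaⱼ j₀ ≡ c
    viaⱼ-j₀ = trans (cong (λ z → c + z * N) (target-zero D₂)) (+-identityʳ c)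

    viaᵢ-j₀ : viaᵢ j₀ ≡ b + N
    viaᵢ-j₀ = trans (cong (λ z → b + z * N) f₁-j₀) (cong (b +_) (+-identityʳ N))

    φ-i₀ : φ i₀ ≡ b
    φ-i₀ = trans (m≤n⇒m⊓n≡m (subst₂ _≤_ (sym viaᵢ-i₀) (sym viaⱼ-i₀) (≤-trans (<⇒≤ b<N) (m≤n+m N c)))) viaᵢ-i₀

    φ-j₀ : φ j₀ ≡ c
    φ-j₀ = trans (m≥n⇒m⊓n≡n (subst₂ _≤_ (sym viaⱼ-j₀) (sym viaᵢ-j₀) (≤-trans (<⇒≤ c<N) (m≤n+m N b)))) viaⱼ-j₀

    φ≤viaᵢ : ∀ u → φ u ≤ viaᵢ u
    φ≤viaᵢ u = m⊓n≤m (viaᵢ u) (viaⱼ u)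

    φ≤viaⱼ : ∀ u → φ u ≤ viaⱼ u
    φ≤viaⱼ u = m⊓n≤n (viaᵢ u) (viaⱼ u)

    φ-residues : ∀ z → φ z ≡ viaᵢ z ⊎ φ z ≡ viaⱼ z
    φ-residues z = ⊓-sel (viaᵢ z) (viaⱼ z)

    φ-adjacent-≤ : ∀ u w → Adj G u w → φ u ≤ N + φ w
    φ-adjacent-≤ u w p = subst (φ u ≤_) (sym (+-distribˡ-⊓ N (viaᵢ w) (viaⱼ w))) (⊓-mono-≤
      (subst (viaᵢ u ≤_) (sym (x∙yz≈y∙xz N b (f₁ w * N))) (+-monoʳ-≤ b (*-monoˡ-≤ N (adjacent-≤ D₁ u w p))))
      (subst (viaⱼ u ≤_) (sym (x∙yz≈y∙xz N c (f₂ w * N))) (+-monoʳ-≤ c (*-monoˡ-≤ N (adjacent-≤ D₂ u w p)))))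

    special-sym : ∀ u w → special u w ≡ special w u
    special-sym u w = does-⇔ (mk⇔ (Joins-sym {e₀} {u} {w}) (Joins-sym {e₀} {w} {u})) (Joins? u w) (Joins? w u)

    special-sum : ∀ u w → Adj G u w → special u w ≡ true → φ u + φ w ≡ N
    special-sum u w _ sp with special⇒Joins sp
    ... | inj₁ (refl , refl) = trans (cong₂ _+_ φ-i₀ φ-j₀) b+c≡N
    ... | inj₂ (refl , refl) = trans (cong₂ _+_ φ-j₀ φ-i₀) c+b≡N

    ordinary : ∀ u w → i₀ ≢ u → j₀ ≢ u → special u w ≡ false
    ordinary u w i₀≢u j₀≢u = dec-false (Joins? u w) λ
      { (inj₁ (i₀≡u , _)) → i₀≢u i₀≡u
      ; (inj₂ (_ , j₀≡u)) → j₀≢u j₀≡u }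

    profile-special : ∀ u w a → special u w ≡ true → profile u w a ≡ ∣ a - φ u ∣
    profile-special u w a sp rewrite sp = refl

    a+[N∸a] : ∀ {a} → a ≤ k → a + (N ∸ a) ≡ N
    a+[N∸a] a≤k = m+[n∸m]≡n (≤-trans a≤k (n≤1+n k))

    no-tie : ∀ u w → Adj G u w → special u w ≡ false → ∀ a → 1 ≤ a → a ≤ k → a + φ u ≢ (N ∸ a) + φ w
    no-tie u w p sp a 1≤a a≤k eq with φ-residues u | φ-residues w
    ... | inj₁ φu | inj₁ φw = no-tie-same-residue a (N ∸ a) b (f₁ u) (f₁ w) (a+[N∸a] a≤k) 1≤a (s≤s a≤k)
                                (subst₂ (λ x y → a + x ≡ (N ∸ a) + y) φu φw eq)
    ... | inj₂ φu | inj₂ φw = no-tie-same-residue a (N ∸ a) c (f₂ u) (f₂ w) (a+[N∸a] a≤k) 1≤a (s≤s a≤k)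
                                (subst₂ (λ x y → a + x ≡ (N ∸ a) + y) φu φw eq)
    ... | inj₁ φu | inj₂ φw with MixedTie.tie⇒centres m (Adj G) (Adj-sym G) D₁ D₂ (≤-reflexive f₂-i₀) (≤-reflexive f₁-j₀)
           b c b+c≡N b<N c<N u w a p (s≤s a≤k) (subst₂ (λ x y → a + x ≡ (N ∸ a) + y) φu φw eq)
           (subst (_≤ viaⱼ u) φu (φ≤viaⱼ u)) (subst (_≤ viaᵢ w) φw (φ≤viaᵢ w))
    ...   | refl , refl = does≡false⇒ (Joins? u w) sp (inj₁ (refl , refl))
    no-tie u w p sp a 1≤a a≤k eq | inj₂ φu | inj₁ φw
      with MixedTie.tie⇒centres m (Adj G) (Adj-sym G) D₂ D₁ (≤-reflexive f₁-j₀) (≤-reflexive f₂-i₀)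
           c b c+b≡N c<N b<N u w a p (s≤s a≤k) (subst₂ (λ x y → a + x ≡ (N ∸ a) + y) φu φw eq)
           (subst (_≤ viaᵢ u) φu (φ≤viaᵢ u)) (subst (_≤ viaⱼ w) φw (φ≤viaⱼ w))
    ...   | refl , refl = does≡false⇒ (Joins? u w) sp (inj₂ (refl , refl))

    φ-step-towards : ∀ {x g} → IsGeodeticDistance (Adj G) x g → ∀ s → (∀ z → φ z ≤ s + g z * N) →
      ∀ u → φ u ≡ s + g u * N → x ≢ u → Σ[ z ∈ Vertex ] Adj G u z × N + φ z ≡ φ u
    φ-step-towards {g = g} D s φ≤ u φu x≢u with g u in gu
    ... | zero = ⊥-elim (x≢u (sym (zero⇒target D u gu)))
    ... | suc α with descent D u α gu
    ...   | z , p , gz = z , p , ≤-antisym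
      (subst (N + φ z ≤_) (trans (x∙yz≈y∙xz N s (α * N)) (sym φu)) (+-monoʳ-≤ N (subst (λ q → φ z ≤ s + q * N) gz (φ≤ z))))
      (φ-adjacent-≤ u z p)

    φ-descent : ∀ u d → φ u ≡ suc d → Σ[ w ∈ Vertex ] Σ[ p ∈ Adj G u w ] profile u w 1 ≡ d
    φ-descent u d eq = go (i₀ Fin.≟ u) (j₀ Fin.≟ u)
      where
      along-e₀ : ∀ w → Joins e₀ u w → profile u w 1 ≡ d
      along-e₀ w joins = trans (profile-special u w 1 (dec-true (Joins? u w) joins)) (cong (λ z → ∣ 1 - z ∣) eq)
      go : Dec (i₀ ≡ u) → Dec (j₀ ≡ u) → Σ[ w ∈ Vertex ] Σ[ p ∈ Adj G u w ] profile u w 1 ≡ d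
      go (yes refl) _          = j₀ , edge-adj e₀ , along-e₀ j₀ (inj₁ (refl , refl))
      go (no _)     (yes refl) = i₀ , Adj-sym G (edge-adj e₀) , along-e₀ i₀ (inj₂ (refl , refl))
      go (no i₀≢u)  (no j₀≢u) with φ-residues u
      ... | inj₁ φu with φ-step-towards D₁ b φ≤viaᵢ u φu i₀≢u
      ...   | z , p , φz = z , p , descent-second-vertex u z d (ordinary u z i₀≢u j₀≢u) eq φz
      go (no i₀≢u)  (no j₀≢u) | inj₂ φu with φ-step-towards D₂ c φ≤viaⱼ u φu j₀≢u
      ...   | z , p , φz = z , p , descent-second-vertex u z d (ordinary u z i₀≢u j₀≢u) eq φz

    descent-keeps-residue : ∀ (g g′ : Vertex → ℕ) s s′ → s + s′ ≡ N → 1 ≤ s → s < N → ∀ u z →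
      φ u ≡ s + g u * N → N + φ z ≡ φ u → φ z ≡ s + g z * N ⊎ φ z ≡ s′ + g′ z * N → g u ≡ suc (g z)
    descent-keeps-residue g g′ s s′ ss′ 1≤s s<N u z φu φz (inj₁ same) =
      sym (*-cancelʳ-≡ (suc (g z)) (g u) N (+-cancelˡ-≡ s _ _
        (trans (sym (x∙yz≈y∙xz N s (g z * N))) (trans (cong (N +_) (sym same)) (trans φz φu)))))
    descent-keeps-residue g g′ s s′ ss′ 1≤s s<N u z φu φz (inj₂ other) =
      ⊥-elim (complementary-residues-distinct s s′ (g u) (suc (g′ z)) ss′ 1≤s s<N
        (sym (trans (sym (x∙yz≈y∙xz N s′ (g′ z * N))) (trans (cong (N +_) (sym other)) (trans φz φu)))))

    second-vertex-descent-cases : ∀ u z d → φ u ≡ suc d → profile u z 1 ≡ d → Joins e₀ u z ⊎ N + φ z ≡ φ u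
    second-vertex-descent-cases u z d eq pr = go (special u z) refl
      where
      go : ∀ β → special u z ≡ β → Joins e₀ u z ⊎ N + φ z ≡ φ u
      go true  sp = inj₁ (special⇒Joins sp)
      go false sp = inj₂ (second-vertex-descent u z d sp eq pr)

    ¬long-step : ∀ {u z s} → s < N → φ u ≡ s → N + φ z ≢ φ u
    ¬long-step s<N φu φz = 1+n≰n (≤-trans s<N (subst (N ≤_) (trans φz φu) (m≤m+n N _)))

    descent-from-i₀ : ∀ z d → φ i₀ ≡ suc d → profile i₀ z 1 ≡ d → z ≡ j₀
    descent-from-i₀ z d eq pr with second-vertex-descent-cases i₀ z d eq pr
    ... | inj₁ (inj₁ (_ , j₀≡z))  = sym j₀≡z
    ... | inj₁ (inj₂ (_ , j₀≡i₀)) = ⊥-elim (src≢tgt e₀ (sym j₀≡i₀))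
    ... | inj₂ φz = ⊥-elim (¬long-step b<N φ-i₀ φz)

    descent-from-j₀ : ∀ z d → φ j₀ ≡ suc d → profile j₀ z 1 ≡ d → z ≡ i₀
    descent-from-j₀ z d eq pr with second-vertex-descent-cases j₀ z d eq pr
    ... | inj₁ (inj₂ (i₀≡z , _))  = sym i₀≡z
    ... | inj₁ (inj₁ (i₀≡j₀ , _)) = ⊥-elim (src≢tgt e₀ i₀≡j₀)
    ... | inj₂ φz = ⊥-elim (¬long-step c<N φ-j₀ φz)

    descent-off-e₀ : ∀ u z d → i₀ ≢ u → j₀ ≢ u → φ u ≡ suc d → profile u z 1 ≡ d → N + φ z ≡ φ u
    descent-off-e₀ u z d i₀≢u j₀≢u eq pr with second-vertex-descent-cases u z d eq pr
    ... | inj₁ (inj₁ (i₀≡u , _)) = ⊥-elim (i₀≢u i₀≡u)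
    ... | inj₁ (inj₂ (_ , j₀≡u)) = ⊥-elim (j₀≢u j₀≡u)
    ... | inj₂ φz = φz

    descent-off-e₀-unique : ∀ u d w w′ → Adj G u w → Adj G u w′ → i₀ ≢ u → j₀ ≢ u → φ u ≡ suc d →
      profile u w 1 ≡ d → profile u w′ 1 ≡ d → w ≡ w′
    descent-off-e₀-unique u d w w′ p p′ i₀≢u j₀≢u eq pr pr′ with φ-residues u
    ... | inj₁ φu = descent-unique D₁ u (f₁ w) w w′ (f₁-step w pr) p refl p′
                      (suc-injective (trans (sym (f₁-step w′ pr′)) (f₁-step w pr)))
      where
      f₁-step : ∀ z → profile u z 1 ≡ d → f₁ u ≡ suc (f₁ z)
      f₁-step z pr = descent-keeps-residue f₁ f₂ b c b+c≡N (s≤s z≤n) b<N u z φu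
        (descent-off-e₀ u z d i₀≢u j₀≢u eq pr) (φ-residues z)
    ... | inj₂ φu = descent-unique D₂ u (f₂ w) w w′ (f₂-step w pr) p refl p′
                      (suc-injective (trans (sym (f₂-step w′ pr′)) (f₂-step w pr)))
      where
      f₂-step : ∀ z → profile u z 1 ≡ d → f₂ u ≡ suc (f₂ z)
      f₂-step z pr = descent-keeps-residue f₂ f₁ c b c+b≡N 1≤c c<N u z φu
        (descent-off-e₀ u z d i₀≢u j₀≢u eq pr) (swap (φ-residues z))

    φ-descent-unique : ∀ u d w w′ → Adj G u w → Adj G u w′ → φ u ≡ suc d →
      profile u w 1 ≡ d → profile u w′ 1 ≡ d → w ≡ w′
    φ-descent-unique u d w w′ p p′ eq pr pr′ = go (i₀ Fin.≟ u) (j₀ Fin.≟ u)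
      where
      go : Dec (i₀ ≡ u) → Dec (j₀ ≡ u) → w ≡ w′
      go (yes refl) _          = trans (descent-from-i₀ w d eq pr) (sym (descent-from-i₀ w′ d eq pr′))
      go (no _)     (yes refl) = trans (descent-from-j₀ w d eq pr) (sym (descent-from-j₀ w′ d eq pr′))
      go (no i₀≢u)  (no j₀≢u)  = descent-off-e₀-unique u d w w′ p p′ i₀≢u j₀≢u eq pr pr′

    φ-nonzero : ∀ u → φ u ≢ 0
    φ-nonzero u eq with φ-residues u
    ... | inj₁ φu with trans (sym φu) eq
    ...   | ()
    φ-nonzero u eq | inj₂ φu with subst (1 ≤_) (m+n≡0⇒m≡0 c (trans (sym φu) eq)) 1≤c
    ...   | ()

    extend-zero⇒target : ∀ y → extend y ≡ 0 → y ≡ inj₂ (e₀ , t₀)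
    extend-zero⇒target (inj₁ u) eq = ⊥-elim (φ-nonzero u eq)
    extend-zero⇒target (inj₂ (e , t)) eq = go (special (src e) (tgt e)) refl
      where
      go : ∀ β → special (src e) (tgt e) ≡ β → inj₂ (e , t) ≡ inj₂ (e₀ , t₀)
      go false sp = ⊥-elim (profile-interior-nonzero (src e) (tgt e) (suc (toℕ t)) sp (s≤s z≤n) (Fin.toℕ<n t) eq)
      go true  sp with special⇒Joins sp
      ... | inj₂ (i₀≡tgt , j₀≡src) = ⊥-elim (¬edge-reversed e₀ e i₀≡tgt j₀≡src)
      ... | inj₁ (i₀≡src , j₀≡tgt) with edge-≡ e₀ e i₀≡src j₀≡tgt
      ...   | refl = cong (λ z → inj₂ (e₀ , z)) (Fin.toℕ-injective (suc-injective (∣m-n∣≡0⇒m≡n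
                (trans (sym (cong (λ z → ∣ suc (toℕ t) - z ∣) φ-i₀)) (trans (sym (profile-special i₀ j₀ (suc (toℕ t)) sp)) eq)))))

    conditions : Conditions (inj₂ (e₀ , t₀))
    conditions = record
      { special-sym             = special-sym
      ; φ-adjacent-≤            = λ u w p _ → φ-adjacent-≤ u w p
      ; special-sum             = special-sum
      ; no-tie                  = no-tie
      ; original-descent        = φ-descent
      ; original-descent-unique = φ-descent-unique
      ; extend-target-zero      = trans (profile-special i₀ j₀ b (dec-true (Joins? i₀ j₀) (inj₁ (refl , refl))))
                                    (trans (cong (λ z → ∣ b - z ∣) φ-i₀) (∣n-n∣≡0 b))
      ; extend-zero⇒target      = extend-zero⇒target
      }

    isGeodeticDistance : IsGeodeticDistance (SubAdj G k) (inj₂ (e₀ , t₀)) extend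
    isGeodeticDistance = extend-isGeodeticDistance conditions

geodetic⇒subdivision-geodetic : ∀ (G : SimpleGraph) m → Geodetic (Adj G) → Geodetic (SubAdj G (m + m))
geodetic⇒subdivision-geodetic G m geodetic = geodetic-from-distances (SubAdj G (m + m)) distance-to
  where
  open GeodeticDistance (Adj G) geodetic using (isGeodeticDistance)
  open Subdivision G (m + m) using (src; tgt)
  distance-to : ∀ τ → ∃[ F ] IsGeodeticDistance (SubAdj G (m + m)) τ F
  distance-to (inj₁ v)        = _ , OriginalTarget.isGeodeticDistance G m v _ (isGeodeticDistance v)
  distance-to (inj₂ (e , t)) = _ , InteriorTarget.isGeodeticDistance G m e t
                                     (isGeodeticDistance (src e)) (isGeodeticDistance (tgt e))

proposition1 : (k : ℕ) → 2 ∣ k → (G : SimpleGraph) →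
    Geodetic (SubAdj G k) ⇔ Geodetic (Adj G)
proposition1 k (divides m refl) G = subst (λ k → Geodetic (SubAdj G k) ⇔ Geodetic (Adj G)) (sym (m*2≡m+m m))
  (mk⇔ (subdivision-geodetic⇒geodetic G (m + m)) (geodetic⇒subdivision-geodetic G m))
  where
  m*2≡m+m : ∀ m → m * 2 ≡ m + m
  m*2≡m+m = solve-∀
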